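{- Let $p$ be an odd prime. For all integers $a,b\geq0$, in $\mathbb{F}_p(x)$ we have \[ G_{a,b}(x-1)-S_{a,b}(x)=\frac{1}{x-1}G_{a-1,b}(x-1)-\frac{1}{x}S_{a,b-1}(x). \]
   Context: $\mathbb{F}_p=\mathbb{Z}/p\mathbb{Z}$ and $\mathbb{F}_p(x)$ is the field of rational functions in $x$; for $g\in\mathbb{F}_p(x)$, $g(x-1)$ denotes the rational function obtained by substituting $x-1$ for $x$. For $m\geq0$ and $y_1,\dots,y_m\in\mathbb{F}_p(x)\setminus\mathbb{F}_p$, let $f(y_{1},\dots,y_{m}):=\sum_{0<n_{1}<\cdots<n_{m}<p}\prod_{j=1}^m\frac{1}{n_{j}-y_{j}}$ (with $f()=1$), and for $y_0,\dots,y_{m+1}\in\mathbb{F}_p(x)\setminus\mathbb{F}_p$ let $\tilde f(y_0,y_1,\dots,y_m,y_{m+1}):=\frac{1}{y_0y_{m+1}}f(y_1,\dots,y_m)$. For integers $a,b\geq-1$ with $(a,b)\neq(-1,-1)$ define $G_{a,b}(x):=x^{2}\tilde{f}(\underbrace{x,\dots,x}_{a+1},2x,\underbrace{x,\dots,x}_{b+1})$ and $S_{a,b}(x):=x^{2}\tilde{f}(\underbrace{x,\dots,x}_{a+1},2x-1,\underbrace{x,\dots,x}_{b+1})$. (Thus for $a,b\ge0$, $G_{a,b}(x)=f(x,\dots,x,2x,x,\dots,x)$ and $S_{a,b}(x)=f(x,\dots,x,2x-1,x,\dots,x)$ with $a$ copies of $x$ before and $b$ after; if $a=-1$ or $b=-1$,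 $G_{a,b}(x)=\frac12 f(x,\dots,x)$ and $S_{a,b}(x)=\frac{x}{2x-1}f(x,\dots,x)$ with $a+b+1$ arguments.) -}

module Defs where

-- A concrete model of the rational function field F_p(x).
--   * F_p[x] is modelled as Z[x] modulo p: a polynomial is a list of integer
--     coefficients (lowest degree first); two polynomials are equal in F_p[x]
--     iff every coefficient of their difference is divisible by p.
--   * F_p(x) is modelled as fractions num/den of such polynomials, with
--     n1/d1 = n2/d2 iff n1*d2 - n2*d1 = 0 in F_p[x]  (for nonzero denominators).

open import Data.Nat using (ℕ; zero; suc; _∸_)
import Data.Nat as N
open import Data.Integer using (ℤ; +_)
import Data.Integer as Z
open import Data.Integer.Divisibility using (_∣_)
open import Data.List using (List; []; _∷_; map; upTo; replicate; _++_; foldr)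
open import Data.List.Relation.Unary.All using (All)
open import Data.Product using (_×_; _,_)
open import Relation.Nullary using (¬_)

Poly : Set
Poly = List ℤ

_+P_ : Poly → Poly → Poly
[] +P g = g
(a ∷ f) +P [] = a ∷ f
(a ∷ f) +P (b ∷ g) = (a Z.+ b) ∷ (f +P g)

scaleP : ℤ → Poly → Poly
scaleP c f = map (c Z.*_) f

_*P_ : Poly → Poly → Poly
[] *P g = []
(a ∷ f) *P g = scaleP a g +P (+ 0 ∷ (f *P g))

negP : Poly → Poly
negP = map (λ c → Z.- c)

_-P_ : Poly → Poly → Poly
f -P g = f +P negP g

ZeroP : ℕ → Poly → Set
ZeroP p f = All (λ c → (+ p) ∣ c) f

record RatF : Set where
  constructor _/_
  field
    num : Poly
    den : Poly
open RatF public

_+R_ : RatF → RatF → RatF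
(a / b) +R (c / d) = ((a *P d) +P (c *P b)) / (b *P d)

_*R_ : RatF → RatF → RatF
(a / b) *R (c / d) = (a *P c) / (b *P d)

-R_ : RatF → RatF
-R (a / b) = negP a / b

_-R_ : RatF → RatF → RatF
r -R s = r +R (-R s)

invR : RatF → RatF
invR (a / b) = b / a

constR : ℤ → RatF
constR c = (c ∷ []) / (+ 1 ∷ [])

natR : ℕ → RatF
natR n = constR (+ n)

X : RatF
X = (+ 0 ∷ + 1 ∷ []) / (+ 1 ∷ [])

_≈[_]_ : RatF → ℕ → RatF → Set
r ≈[ p ] s = ZeroP p ((num r *P den s) -P (num s *P den r))

WellDefined : ℕ → RatF → Set
WellDefined p r = ¬ ZeroP p (den r)

sumR : List RatF → RatF
sumR = foldr _+R_ (natR 0)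

above : ℕ → ℕ → List ℕ
above p lo = map (λ k → suc lo N.+ k) (upTo (p ∸ suc lo))

-- fFrom p lo (y₁ ∷ … ∷ yₘ) = Σ_{lo < n₁ < ⋯ < nₘ < p} ∏ⱼ 1/(nⱼ - yⱼ)
fFrom : ℕ → ℕ → List RatF → RatF
fFrom p lo [] = natR 1
fFrom p lo (y ∷ ys) =
  sumR (map (λ n → invR (natR n -R y) *R fFrom p n ys) (above p lo))

fF : ℕ → List RatF → RatF
fF p ys = fFrom p 0 ys

splitLast : RatF → List RatF → List RatF × RatF
splitLast y [] = ([] , y)
splitLast y (z ∷ zs) with splitLast z zs
... | (i , l) = (y ∷ i , l)

-- f̃(y₀,y₁,…,yₘ,yₘ₊₁) = 1/(y₀ yₘ₊₁) f(y₁,…,yₘ); only used on lists of length ≥ 2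
fTilde : ℕ → List RatF → RatF
fTilde p [] = natR 0
fTilde p (y ∷ []) = natR 0
fTilde p (y₀ ∷ z ∷ zs) with splitLast z zs
... | (mid , yl) = invR (y₀ *R yl) *R fF p mid

two : RatF → RatF
two t = natR 2 *R t

-- With A = a+1 and B = b+1 (a, b ≥ -1):
--   Gc p A B t = G_{a,b}(t) = t² f̃(t,…,t (A times), 2t, t,…,t (B times))
--   Sc p A B t = S_{a,b}(t) = t² f̃(t,…,t (A times), 2t-1, t,…,t (B times))
-- Evaluating at t = x gives G_{a,b}(x); at t = x - 1 gives G_{a,b}(x-1).
Gc : ℕ → ℕ → ℕ → RatF → RatF
Gc p A B t = (t *R t) *R fTilde p (replicate A t ++ (two t ∷ replicate B t))

Sc : ℕ → ℕ → ℕ → RatF → RatF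
Sc p A B t = (t *R t) *R fTilde p (replicate A t ++ ((two t -R natR 1) ∷ replicate B t))

module Submission where

-- Write f_q^lo(z₁,…,zₘ) = Σ_{lo<n₁<⋯<nₘ<q} ∏ⱼ 1/(nⱼ - zⱼ), so f = f_p^0.  Replacing
-- every zⱼ by zⱼ - 1 shifts all indices by one:  f_p^0(z - 1) = f_{p+1}^1(z).  The ranges
-- 1 < n₁ < ⋯ < nₘ ≤ p and 0 < n₁ < ⋯ < nₘ < p differ only in the boundary terms nₘ = p
-- and n₁ = 1, which gives the boundary identity
--   f_{p+1}^1(z) - f_p^0(z) = (1/(p - zₘ)) f(z₁,…,zₘ₋₁) - (1/(1 - z₁)) f_{p+1}^1(z₂,…,zₘ).
-- For z = (x,…,x,2x-1,x,…,x) the left side is G_{a,b}(x-1) - S_{a,b}(x), and since p = 0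
-- in F_p the two boundary terms are -(1/x) S_{a,b-1}(x) and (1/(x-1)) G_{a-1,b}(x-1).

open import Defs
open import Data.Nat using (ℕ; suc)
open import Data.Nat.Primality using (Prime)
open import Data.Product using (_×_)
open import Relation.Binary.PropositionalEquality using (_≢_; sym; cong₂)

module AlmostCommutativeRingFromLaws where

  open import Level using (0ℓ)
  open import Relation.Binary.Core using (Rel)
  open import Relation.Binary.Structures using (IsEquivalence)
  open import Algebra.Core using (Op₁; Op₂)
  open import Algebra.Solver.Ring.AlmostCommutativeRing using (AlmostCommutativeRing)
  open import Algebra.Structures.Biased using (isCommutativeSemiringˡ)
  open import Data.Product using (_,_)

  module Build {A : Set} (_≈_ : Rel A 0ℓ) (_+_ _*_ : Op₂ A) (-_ : Op₁ A) (0# 1# : A)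
    (isEq : IsEquivalence _≈_)
    (+-cong : ∀ {x y u v} → x ≈ y → u ≈ v → (x + u) ≈ (y + v))
    (*-cong : ∀ {x y u v} → x ≈ y → u ≈ v → (x * u) ≈ (y * v))
    (+-assoc : ∀ x y z → ((x + y) + z) ≈ (x + (y + z)))
    (+-comm : ∀ x y → (x + y) ≈ (y + x))
    (+-idˡ : ∀ x → (0# + x) ≈ x)
    (*-assoc : ∀ x y z → ((x * y) * z) ≈ (x * (y * z)))
    (*-comm : ∀ x y → (x * y) ≈ (y * x))
    (*-idˡ : ∀ x → (1# * x) ≈ x)
    (distribʳ : ∀ x y z → ((y + z) * x) ≈ ((y * x) + (z * x)))
    (zeroˡ : ∀ x → (0# * x) ≈ 0#)
    (-cong : ∀ {x y} → x ≈ y → (- x) ≈ (- y))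
    (-*ˡ : ∀ x y → ((- x) * y) ≈ (- (x * y)))
    (-+ : ∀ x y → ((- x) + (- y)) ≈ (- (x + y)))
    where
    open IsEquivalence isEq

    +-idʳ : ∀ x → (x + 0#) ≈ x
    +-idʳ x = trans (+-comm x 0#) (+-idˡ x)

    *-idʳ : ∀ x → (x * 1#) ≈ x
    *-idʳ x = trans (*-comm x 1#) (*-idˡ x)

    ring : AlmostCommutativeRing 0ℓ 0ℓ
    ring = record
      { Carrier = A ; _≈_ = _≈_ ; _+_ = _+_ ; _*_ = _*_ ; -_ = -_ ; 0# = 0# ; 1# = 1#
      ; isAlmostCommutativeRing = record
        { isCommutativeSemiring = isCommutativeSemiringˡ (record
          { +-isCommutativeMonoid = record
            { isMonoid = record
              { isSemigroup = record { isMagma = record { isEquivalence = isEq ; ∙-cong = +-cong } ; assoc = +-assoc }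
              ; identity = +-idˡ , +-idʳ }
            ; comm = +-comm }
          ; *-isCommutativeMonoid = record
            { isMonoid = record
              { isSemigroup = record { isMagma = record { isEquivalence = isEq ; ∙-cong = *-cong } ; assoc = *-assoc }
              ; identity = *-idˡ , *-idʳ }
            ; comm = *-comm }
          ; distribʳ = distribʳ
          ; zeroˡ = zeroˡ })
        ; -‿cong = -cong
        ; -‿*-distribˡ = -*ˡ
        ; -‿+-comm = -+ } }

-- ℤ[x] up to coefficientwise equality: all ring laws hold, so the ring solver applies.
module Polynomials where

  open import Data.Nat using (zero)
  open import Data.Integer using (ℤ; +_; 0ℤ; 1ℤ; _+_; _*_; -_)
  import Data.Integer.Properties as ℤP
  open import Data.Integer.Solver using (module +-*-Solver)
  open import Data.List using ([]; _∷_)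
  open import Data.Maybe using (Maybe; just; nothing)
  open import Relation.Nullary using (yes; no)
  open import Relation.Binary.PropositionalEquality
  open import Relation.Binary.Structures using (IsEquivalence)
  open import Algebra.Bundles using (CommutativeRing)
  open import Algebra.Solver.Ring.AlmostCommutativeRing
    using (AlmostCommutativeRing; _-Raw-AlmostCommutative⟶_)
  import Algebra.Solver.Ring

  -- the coefficient of xⁱ; lists are padded by zeros
  coeff : Poly → ℕ → ℤ
  coeff [] _ = 0ℤ
  coeff (a ∷ f) zero = a
  coeff (a ∷ f) (suc i) = coeff f i

  tailP : Poly → Poly
  tailP [] = []
  tailP (a ∷ f) = f

  infix 4 _≐_
  _≐_ : Poly → Poly → Set
  f ≐ g = ∀ i → coeff f i ≡ coeff g i

  ≐-sym : ∀ {f g} → f ≐ g → g ≐ f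
  ≐-sym e i = sym (e i)

  ≐-trans : ∀ {f g h} → f ≐ g → g ≐ h → f ≐ h
  ≐-trans e e' i = trans (e i) (e' i)

  coeff-tailP : ∀ f i → coeff (tailP f) i ≡ coeff f (suc i)
  coeff-tailP [] i = refl
  coeff-tailP (a ∷ f) i = refl

  coeff-+ : ∀ f g i → coeff (f +P g) i ≡ coeff f i + coeff g i
  coeff-+ [] g i = sym (ℤP.+-identityˡ _)
  coeff-+ (a ∷ f) [] zero = sym (ℤP.+-identityʳ _)
  coeff-+ (a ∷ f) [] (suc i) = sym (ℤP.+-identityʳ _)
  coeff-+ (a ∷ f) (b ∷ g) zero = refl
  coeff-+ (a ∷ f) (b ∷ g) (suc i) = coeff-+ f g i

  coeff-scale : ∀ c f i → coeff (scaleP c f) i ≡ c * coeff f i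
  coeff-scale c [] i = sym (ℤP.*-zeroʳ c)
  coeff-scale c (a ∷ f) zero = refl
  coeff-scale c (a ∷ f) (suc i) = coeff-scale c f i

  coeff-neg : ∀ f i → coeff (negP f) i ≡ - coeff f i
  coeff-neg [] i = refl
  coeff-neg (a ∷ f) zero = refl
  coeff-neg (a ∷ f) (suc i) = coeff-neg f i

  coeff-*-0 : ∀ f g → coeff (f *P g) 0 ≡ coeff f 0 * coeff g 0
  coeff-*-0 [] g = refl
  coeff-*-0 (a ∷ f) g = trans (coeff-+ (scaleP a g) (+ 0 ∷ (f *P g)) 0)
    (trans (ℤP.+-identityʳ _) (coeff-scale a g 0))

  coeff-*-suc : ∀ f g i → coeff (f *P g) (suc i) ≡ coeff f 0 * coeff g (suc i) + coeff (tailP f *P g) i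
  coeff-*-suc [] g i = refl
  coeff-*-suc (a ∷ f) g i = trans (coeff-+ (scaleP a g) (+ 0 ∷ (f *P g)) (suc i))
    (cong (_+ coeff (f *P g) i) (coeff-scale a g (suc i)))

  coeff-*-suc′ : ∀ f g i → coeff (f *P g) (suc i) ≡ coeff f (suc i) * coeff g 0 + coeff (f *P tailP g) i
  coeff-*-suc′ [] g i = refl
  coeff-*-suc′ (a ∷ f) g zero = begin
      coeff ((a ∷ f) *P g) 1
    ≡⟨ coeff-*-suc (a ∷ f) g 0 ⟩
      a * coeff g 1 + coeff (f *P g) 0
    ≡⟨ cong₂ (λ u v → a * u + v) (sym (coeff-tailP g 0)) (coeff-*-0 f g) ⟩
      a * coeff (tailP g) 0 + coeff f 0 * coeff g 0
    ≡⟨ ℤP.+-comm (a * coeff (tailP g) 0) (coeff f 0 * coeff g 0) ⟩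
      coeff f 0 * coeff g 0 + a * coeff (tailP g) 0
    ≡⟨ cong (λ v → coeff f 0 * coeff g 0 + v) (sym (coeff-*-0 (a ∷ f) (tailP g))) ⟩
      coeff f 0 * coeff g 0 + coeff ((a ∷ f) *P tailP g) 0
    ∎ where open ≡-Reasoning
  coeff-*-suc′ (a ∷ f) g (suc i) = begin
      coeff ((a ∷ f) *P g) (suc (suc i))
    ≡⟨ coeff-*-suc (a ∷ f) g (suc i) ⟩
      a * coeff g (suc (suc i)) + coeff (f *P g) (suc i)
    ≡⟨ cong₂ (λ u v → a * u + v) (sym (coeff-tailP g (suc i))) (coeff-*-suc′ f g i) ⟩
      a * coeff (tailP g) (suc i) + (coeff f (suc i) * coeff g 0 + coeff (f *P tailP g) i)
    ≡⟨ exchange (a * coeff (tailP g) (suc i)) (coeff f (suc i) * coeff g 0) (coeff (f *P tailP g) i) ⟩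
      coeff f (suc i) * coeff g 0 + (a * coeff (tailP g) (suc i) + coeff (f *P tailP g) i)
    ≡⟨ cong (λ v → coeff f (suc i) * coeff g 0 + v) (sym (coeff-*-suc (a ∷ f) (tailP g) i)) ⟩
      coeff f (suc i) * coeff g 0 + coeff ((a ∷ f) *P tailP g) (suc i)
    ∎ where
      open ≡-Reasoning
      open +-*-Solver
      exchange : ∀ x y z → x + (y + z) ≡ y + (x + z)
      exchange = solve 3 (λ x y z → x :+ (y :+ z) := y :+ (x :+ z)) refl

  tailP-scale : ∀ c f → tailP (scaleP c f) ≡ scaleP c (tailP f)
  tailP-scale c [] = refl
  tailP-scale c (a ∷ f) = refl

  tailP-+ : ∀ f g → tailP (f +P g) ≐ (tailP f +P tailP g)
  tailP-+ f g i = begin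
      coeff (tailP (f +P g)) i              ≡⟨ coeff-tailP (f +P g) i ⟩
      coeff (f +P g) (suc i)                ≡⟨ coeff-+ f g (suc i) ⟩
      coeff f (suc i) + coeff g (suc i)     ≡⟨ cong₂ _+_ (sym (coeff-tailP f i)) (sym (coeff-tailP g i)) ⟩
      coeff (tailP f) i + coeff (tailP g) i ≡⟨ sym (coeff-+ (tailP f) (tailP g) i) ⟩
      coeff (tailP f +P tailP g) i          ∎
    where open ≡-Reasoning

  tailP-* : ∀ f g → tailP (f *P g) ≐ (scaleP (coeff f 0) (tailP g) +P (tailP f *P g))
  tailP-* f g i = begin
      coeff (tailP (f *P g)) i
    ≡⟨ trans (coeff-tailP (f *P g) i) (coeff-*-suc f g i) ⟩
      coeff f 0 * coeff g (suc i) + coeff (tailP f *P g) i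
    ≡⟨ cong (λ v → v + coeff (tailP f *P g) i)
         (trans (cong (coeff f 0 *_) (sym (coeff-tailP g i))) (sym (coeff-scale (coeff f 0) (tailP g) i))) ⟩
      coeff (scaleP (coeff f 0) (tailP g)) i + coeff (tailP f *P g) i
    ≡⟨ sym (coeff-+ (scaleP (coeff f 0) (tailP g)) (tailP f *P g) i) ⟩
      coeff (scaleP (coeff f 0) (tailP g) +P (tailP f *P g)) i
    ∎ where open ≡-Reasoning

  +P-cong : ∀ {f f' g g'} → f ≐ f' → g ≐ g' → (f +P g) ≐ (f' +P g')
  +P-cong {f} {f'} {g} {g'} e e' i =
    trans (coeff-+ f g i) (trans (cong₂ _+_ (e i) (e' i)) (sym (coeff-+ f' g' i)))

  +P-comm : ∀ f g → (f +P g) ≐ (g +P f)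
  +P-comm f g i = trans (coeff-+ f g i) (trans (ℤP.+-comm (coeff f i) (coeff g i)) (sym (coeff-+ g f i)))

  +P-assoc : ∀ f g h → ((f +P g) +P h) ≐ (f +P (g +P h))
  +P-assoc f g h i = begin
      coeff ((f +P g) +P h) i                  ≡⟨ coeff-+ (f +P g) h i ⟩
      coeff (f +P g) i + coeff h i             ≡⟨ cong (_+ coeff h i) (coeff-+ f g i) ⟩
      coeff f i + coeff g i + coeff h i        ≡⟨ ℤP.+-assoc (coeff f i) (coeff g i) (coeff h i) ⟩
      coeff f i + (coeff g i + coeff h i)      ≡⟨ cong (λ v → coeff f i + v) (sym (coeff-+ g h i)) ⟩
      coeff f i + coeff (g +P h) i             ≡⟨ sym (coeff-+ f (g +P h) i) ⟩
      coeff (f +P (g +P h)) i                  ∎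
    where open ≡-Reasoning

  negP-cong : ∀ {f g} → f ≐ g → negP f ≐ negP g
  negP-cong {f} {g} e i = trans (coeff-neg f i) (trans (cong -_ (e i)) (sym (coeff-neg g i)))

  negP-+ : ∀ f g → (negP f +P negP g) ≐ negP (f +P g)
  negP-+ f g i = begin
      coeff (negP f +P negP g) i           ≡⟨ coeff-+ (negP f) (negP g) i ⟩
      coeff (negP f) i + coeff (negP g) i  ≡⟨ cong₂ _+_ (coeff-neg f i) (coeff-neg g i) ⟩
      - coeff f i + - coeff g i            ≡⟨ sym (ℤP.neg-distrib-+ (coeff f i) (coeff g i)) ⟩
      - (coeff f i + coeff g i)            ≡⟨ cong -_ (sym (coeff-+ f g i)) ⟩
      - coeff (f +P g) i                   ≡⟨ sym (coeff-neg (f +P g) i) ⟩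
      coeff (negP (f +P g)) i              ∎
    where open ≡-Reasoning

  *P-congˡ : ∀ f f' g → f ≐ f' → (f *P g) ≐ (f' *P g)
  *P-congˡ f f' g e zero =
    trans (coeff-*-0 f g) (trans (cong (_* coeff g 0) (e 0)) (sym (coeff-*-0 f' g)))
  *P-congˡ f f' g e (suc i) = trans (coeff-*-suc f g i)
    (trans (cong₂ (λ u v → u * coeff g (suc i) + v) (e 0) (*P-congˡ (tailP f) (tailP f') g tail-eq i))
           (sym (coeff-*-suc f' g i)))
    where
      tail-eq : tailP f ≐ tailP f'
      tail-eq j = trans (coeff-tailP f j) (trans (e (suc j)) (sym (coeff-tailP f' j)))

  *P-comm : ∀ f g → (f *P g) ≐ (g *P f)
  *P-comm f g zero = trans (coeff-*-0 f g) (trans (ℤP.*-comm (coeff f 0) (coeff g 0)) (sym (coeff-*-0 g f)))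
  *P-comm f g (suc i) = trans (coeff-*-suc f g i)
    (trans (cong₂ _+_ (ℤP.*-comm (coeff f 0) (coeff g (suc i))) (*P-comm (tailP f) g i))
           (sym (coeff-*-suc′ g f i)))

  *P-cong : ∀ {f f' g g'} → f ≐ f' → g ≐ g' → (f *P g) ≐ (f' *P g')
  *P-cong {f} {f'} {g} {g'} e e' = ≐-trans {f *P g} {f' *P g} {f' *P g'} (*P-congˡ f f' g e)
    (≐-trans {f' *P g} {g *P f'} {f' *P g'} (*P-comm f' g)
      (≐-trans {g *P f'} {g' *P f'} {f' *P g'} (*P-congˡ g g' f' e') (*P-comm g' f')))

  scale-* : ∀ c f h i → coeff (scaleP c f *P h) i ≡ c * coeff (f *P h) i
  scale-* c f h zero = begin
      coeff (scaleP c f *P h) 0            ≡⟨ coeff-*-0 (scaleP c f) h ⟩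
      coeff (scaleP c f) 0 * coeff h 0     ≡⟨ cong (_* coeff h 0) (coeff-scale c f 0) ⟩
      c * coeff f 0 * coeff h 0            ≡⟨ ℤP.*-assoc c (coeff f 0) (coeff h 0) ⟩
      c * (coeff f 0 * coeff h 0)          ≡⟨ cong (c *_) (sym (coeff-*-0 f h)) ⟩
      c * coeff (f *P h) 0                 ∎
    where open ≡-Reasoning
  scale-* c f h (suc i) = begin
      coeff (scaleP c f *P h) (suc i)
    ≡⟨ coeff-*-suc (scaleP c f) h i ⟩
      coeff (scaleP c f) 0 * coeff h (suc i) + coeff (tailP (scaleP c f) *P h) i
    ≡⟨ cong₂ (λ u v → u * coeff h (suc i) + v) (coeff-scale c f 0)
         (trans (cong (λ w → coeff (w *P h) i) (tailP-scale c f)) (scale-* c (tailP f) h i)) ⟩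
      c * coeff f 0 * coeff h (suc i) + c * coeff (tailP f *P h) i
    ≡⟨ factor c (coeff f 0) (coeff h (suc i)) (coeff (tailP f *P h) i) ⟩
      c * (coeff f 0 * coeff h (suc i) + coeff (tailP f *P h) i)
    ≡⟨ cong (c *_) (sym (coeff-*-suc f h i)) ⟩
      c * coeff (f *P h) (suc i)
    ∎ where
      open ≡-Reasoning
      open +-*-Solver
      factor : ∀ x y z w → x * y * z + x * w ≡ x * (y * z + w)
      factor = solve 4 (λ x y z w → x :* y :* z :+ x :* w := x :* (y :* z :+ w)) refl

  *P-distribʳ : ∀ g f h → ((f +P h) *P g) ≐ ((f *P g) +P (h *P g))
  *P-distribʳ g f h zero = begin
      coeff ((f +P h) *P g) 0                       ≡⟨ coeff-*-0 (f +P h) g ⟩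
      coeff (f +P h) 0 * coeff g 0                  ≡⟨ cong (_* coeff g 0) (coeff-+ f h 0) ⟩
      (coeff f 0 + coeff h 0) * coeff g 0           ≡⟨ ℤP.*-distribʳ-+ (coeff g 0) (coeff f 0) (coeff h 0) ⟩
      coeff f 0 * coeff g 0 + coeff h 0 * coeff g 0 ≡⟨ cong₂ _+_ (sym (coeff-*-0 f g)) (sym (coeff-*-0 h g)) ⟩
      coeff (f *P g) 0 + coeff (h *P g) 0           ≡⟨ sym (coeff-+ (f *P g) (h *P g) 0) ⟩
      coeff ((f *P g) +P (h *P g)) 0                ∎
    where open ≡-Reasoning
  *P-distribʳ g f h (suc i) = begin
      coeff ((f +P h) *P g) (suc i)
    ≡⟨ coeff-*-suc (f +P h) g i ⟩
      coeff (f +P h) 0 * coeff g (suc i) + coeff (tailP (f +P h) *P g) i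
    ≡⟨ cong₂ (λ u v → u * coeff g (suc i) + v) (coeff-+ f h 0)
         (trans (*P-congˡ (tailP (f +P h)) (tailP f +P tailP h) g (tailP-+ f h) i)
         (trans (*P-distribʳ g (tailP f) (tailP h) i) (coeff-+ (tailP f *P g) (tailP h *P g) i))) ⟩
      (coeff f 0 + coeff h 0) * coeff g (suc i) + (coeff (tailP f *P g) i + coeff (tailP h *P g) i)
    ≡⟨ regroup (coeff f 0) (coeff h 0) (coeff g (suc i)) (coeff (tailP f *P g) i) (coeff (tailP h *P g) i) ⟩
      (coeff f 0 * coeff g (suc i) + coeff (tailP f *P g) i) + (coeff h 0 * coeff g (suc i) + coeff (tailP h *P g) i)
    ≡⟨ cong₂ _+_ (sym (coeff-*-suc f g i)) (sym (coeff-*-suc h g i)) ⟩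
      coeff (f *P g) (suc i) + coeff (h *P g) (suc i)
    ≡⟨ sym (coeff-+ (f *P g) (h *P g) (suc i)) ⟩
      coeff ((f *P g) +P (h *P g)) (suc i)
    ∎ where
      open ≡-Reasoning
      open +-*-Solver
      regroup : ∀ a b c d e → (a + b) * c + (d + e) ≡ (a * c + d) + (b * c + e)
      regroup = solve 5 (λ a b c d e → (a :+ b) :* c :+ (d :+ e) := (a :* c :+ d) :+ (b :* c :+ e)) refl

  *P-assoc : ∀ f g h → ((f *P g) *P h) ≐ (f *P (g *P h))
  *P-assoc f g h zero = begin
      coeff ((f *P g) *P h) 0                ≡⟨ coeff-*-0 (f *P g) h ⟩
      coeff (f *P g) 0 * coeff h 0           ≡⟨ cong (_* coeff h 0) (coeff-*-0 f g) ⟩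
      coeff f 0 * coeff g 0 * coeff h 0      ≡⟨ ℤP.*-assoc (coeff f 0) (coeff g 0) (coeff h 0) ⟩
      coeff f 0 * (coeff g 0 * coeff h 0)    ≡⟨ cong (coeff f 0 *_) (sym (coeff-*-0 g h)) ⟩
      coeff f 0 * coeff (g *P h) 0           ≡⟨ sym (coeff-*-0 f (g *P h)) ⟩
      coeff (f *P (g *P h)) 0                ∎
    where open ≡-Reasoning
  *P-assoc f g h (suc i) = begin
      coeff ((f *P g) *P h) (suc i)
    ≡⟨ coeff-*-suc (f *P g) h i ⟩
      coeff (f *P g) 0 * coeff h (suc i) + coeff (tailP (f *P g) *P h) i
    ≡⟨ cong₂ (λ u v → u * coeff h (suc i) + v) (coeff-*-0 f g) tail-part ⟩
      coeff f 0 * coeff g 0 * coeff h (suc i) + (coeff f 0 * coeff (tailP g *P h) i + coeff (tailP f *P (g *P h)) i)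
    ≡⟨ regroup (coeff f 0) (coeff g 0) (coeff h (suc i)) (coeff (tailP g *P h) i) (coeff (tailP f *P (g *P h)) i) ⟩
      coeff f 0 * (coeff g 0 * coeff h (suc i) + coeff (tailP g *P h) i) + coeff (tailP f *P (g *P h)) i
    ≡⟨ cong (λ v → coeff f 0 * v + coeff (tailP f *P (g *P h)) i) (sym (coeff-*-suc g h i)) ⟩
      coeff f 0 * coeff (g *P h) (suc i) + coeff (tailP f *P (g *P h)) i
    ≡⟨ sym (coeff-*-suc f (g *P h) i) ⟩
      coeff (f *P (g *P h)) (suc i)
    ∎ where
      open ≡-Reasoning
      open +-*-Solver
      f₀ = coeff f 0
      tail-part : coeff (tailP (f *P g) *P h) i ≡ f₀ * coeff (tailP g *P h) i + coeff (tailP f *P (g *P h)) i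
      tail-part = begin
          coeff (tailP (f *P g) *P h) i
        ≡⟨ *P-congˡ (tailP (f *P g)) (scaleP f₀ (tailP g) +P (tailP f *P g)) h (tailP-* f g) i ⟩
          coeff ((scaleP f₀ (tailP g) +P (tailP f *P g)) *P h) i
        ≡⟨ *P-distribʳ h (scaleP f₀ (tailP g)) (tailP f *P g) i ⟩
          coeff ((scaleP f₀ (tailP g) *P h) +P ((tailP f *P g) *P h)) i
        ≡⟨ coeff-+ (scaleP f₀ (tailP g) *P h) ((tailP f *P g) *P h) i ⟩
          coeff (scaleP f₀ (tailP g) *P h) i + coeff ((tailP f *P g) *P h) i
        ≡⟨ cong₂ _+_ (scale-* f₀ (tailP g) h i) (*P-assoc (tailP f) g h i) ⟩
          f₀ * coeff (tailP g *P h) i + coeff (tailP f *P (g *P h)) i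
        ∎
      regroup : ∀ a b c d e → a * b * c + (a * d + e) ≡ a * (b * c + d) + e
      regroup = solve 5 (λ a b c d e → a :* b :* c :+ (a :* d :+ e) := a :* (b :* c :+ d) :+ e) refl

  oneP : Poly
  oneP = + 1 ∷ []

  *P-identityˡ : ∀ g → (oneP *P g) ≐ g
  *P-identityˡ g zero = trans (coeff-*-0 oneP g) (ℤP.*-identityˡ (coeff g 0))
  *P-identityˡ g (suc i) = trans (coeff-*-suc oneP g i) (trans (ℤP.+-identityʳ _) (ℤP.*-identityˡ _))

  negP-*ˡ : ∀ f g → (negP f *P g) ≐ negP (f *P g)
  negP-*ˡ f g i = begin
      coeff (negP f *P g) i            ≡⟨ *P-congˡ (negP f) (scaleP (- 1ℤ) f) g negP-as-scale i ⟩
      coeff (scaleP (- 1ℤ) f *P g) i   ≡⟨ scale-* (- 1ℤ) f g i ⟩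
      - 1ℤ * coeff (f *P g) i          ≡⟨ ℤP.-1*i≡-i _ ⟩
      - coeff (f *P g) i               ≡⟨ sym (coeff-neg (f *P g) i) ⟩
      coeff (negP (f *P g)) i          ∎
    where
      open ≡-Reasoning
      negP-as-scale : negP f ≐ scaleP (- 1ℤ) f
      negP-as-scale j = trans (coeff-neg f j) (trans (sym (ℤP.-1*i≡-i (coeff f j))) (sym (coeff-scale (- 1ℤ) f j)))

  *P-cons : ∀ f b g → (f *P (b ∷ g)) ≐ (scaleP b f +P (+ 0 ∷ (f *P g)))
  *P-cons f b g zero = begin
      coeff (f *P (b ∷ g)) 0                     ≡⟨ coeff-*-0 f (b ∷ g) ⟩
      coeff f 0 * b                              ≡⟨ ℤP.*-comm (coeff f 0) b ⟩
      b * coeff f 0                              ≡⟨ sym (ℤP.+-identityʳ _) ⟩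
      b * coeff f 0 + + 0                        ≡⟨ cong (_+ + 0) (sym (coeff-scale b f 0)) ⟩
      coeff (scaleP b f) 0 + + 0                 ≡⟨ sym (coeff-+ (scaleP b f) (+ 0 ∷ (f *P g)) 0) ⟩
      coeff (scaleP b f +P (+ 0 ∷ (f *P g))) 0   ∎
    where open ≡-Reasoning
  *P-cons f b g (suc i) = begin
      coeff (f *P (b ∷ g)) (suc i)                          ≡⟨ coeff-*-suc′ f (b ∷ g) i ⟩
      coeff f (suc i) * b + coeff (f *P g) i                ≡⟨ cong (_+ coeff (f *P g) i) (ℤP.*-comm (coeff f (suc i)) b) ⟩
      b * coeff f (suc i) + coeff (f *P g) i                ≡⟨ cong (_+ coeff (f *P g) i) (sym (coeff-scale b f (suc i))) ⟩
      coeff (scaleP b f) (suc i) + coeff (f *P g) i         ≡⟨ sym (coeff-+ (scaleP b f) (+ 0 ∷ (f *P g)) (suc i)) ⟩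
      coeff (scaleP b f +P (+ 0 ∷ (f *P g))) (suc i)        ∎
    where open ≡-Reasoning

  -- coefficientwise equality, wrapped in a record so that it can be inferred from its indices
  infix 4 _≋_
  record _≋_ (f g : Poly) : Set where
    constructor ⟨_⟩
    field at : f ≐ g
  open _≋_ public

  ≋-refl : ∀ {f} → f ≋ f
  ≋-refl = ⟨ (λ i → refl) ⟩

  ≋-isEquivalence : IsEquivalence _≋_
  ≋-isEquivalence = record
    { refl = ≋-refl
    ; sym = λ {f} {g} e → ⟨ ≐-sym {f} {g} (at e) ⟩
    ; trans = λ {f} {g} {h} e e' → ⟨ ≐-trans {f} {g} {h} (at e) (at e') ⟩ }

  module PolyLaws = AlmostCommutativeRingFromLaws.Build _≋_ _+P_ _*P_ negP [] oneP ≋-isEquivalence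
    (λ {f} {f'} {g} {g'} e e' → ⟨ +P-cong {f} {f'} {g} {g'} (at e) (at e') ⟩)
    (λ {f} {f'} {g} {g'} e e' → ⟨ *P-cong {f} {f'} {g} {g'} (at e) (at e') ⟩)
    (λ f g h → ⟨ +P-assoc f g h ⟩)
    (λ f g → ⟨ +P-comm f g ⟩)
    (λ f → ≋-refl)
    (λ f g h → ⟨ *P-assoc f g h ⟩)
    (λ f g → ⟨ *P-comm f g ⟩)
    (λ f → ⟨ *P-identityˡ f ⟩)
    (λ g f h → ⟨ *P-distribʳ g f h ⟩)
    (λ f → ≋-refl)
    (λ {f} {g} e → ⟨ negP-cong {f} {g} (at e) ⟩)
    (λ f g → ⟨ negP-*ˡ f g ⟩)
    (λ f g → ⟨ negP-+ f g ⟩)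

  polyRing : AlmostCommutativeRing _ _
  polyRing = PolyLaws.ring

  ℤ-rawRing = CommutativeRing.rawRing ℤP.+-*-commutativeRing

  constP : ℤ → Poly
  constP i = i ∷ []

  constP-0 : constP 0ℤ ≐ []
  constP-0 zero = refl
  constP-0 (suc i) = refl

  constP-* : ∀ i j → constP (i * j) ≐ (constP i *P constP j)
  constP-* i j zero = sym (ℤP.+-identityʳ _)
  constP-* i j (suc k) = refl

  constP-hom : ℤ-rawRing -Raw-AlmostCommutative⟶ polyRing
  constP-hom = record
    { ⟦_⟧ = constP
    ; +-homo = λ i j → ≋-refl
    ; *-homo = λ i j → ⟨ constP-* i j ⟩
    ; -‿homo = λ i → ≋-refl
    ; 0-homo = ⟨ constP-0 ⟩
    ; 1-homo = ≋-refl }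

  constP-≟ : ∀ i j → Maybe (constP i ≋ constP j)
  constP-≟ i j with i ℤP.≟ j
  ... | yes refl = just ≋-refl
  ... | no _ = nothing

  module PolySolver = Algebra.Solver.Ring ℤ-rawRing polyRing constP-hom constP-≟

-- F_p[x] is ℤ[x] modulo the polynomials all of whose coefficients are divisible by p; it
-- is an integral domain, so its fractions with nonzero denominators form a field K = F_p(x),
-- presented as a setoid with the ring solver over ℤ.
module FractionField (p : ℕ) (isPrime : Prime p) where

  open Polynomials
  open import Data.Nat using (zero)
  import Data.Nat as ℕ
  import Data.Nat.Properties as ℕP
  import Data.Nat.Divisibility as ℕD
  open import Data.Nat.Primality using (euclidsLemma; prime⇒nonTrivial)
  open import Data.Integer using (ℤ; +_; 0ℤ; 1ℤ; _*_)
  import Data.Integer as ℤ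
  import Data.Integer.Properties as ℤP
  open import Data.Integer.Divisibility.Signed as Div using (divides)
  open import Data.List using ([]; _∷_)
  open import Data.List.Relation.Unary.All using ([]; _∷_)
  open import Data.Sum using (_⊎_; inj₁; inj₂; [_,_]′)
  import Data.Sum as Sum
  open import Data.Product using (Σ; _,_; proj₁)
  open import Data.Empty using (⊥-elim)
  open import Data.Maybe using (Maybe; just; nothing)
  open import Relation.Nullary using (¬_; Dec; yes; no)
  open import Relation.Binary.PropositionalEquality
  open import Relation.Binary.Structures using (IsEquivalence)
  open import Relation.Binary.Bundles using (Setoid)
  import Relation.Binary.Reasoning.Setoid as SetoidReasoning
  open import Algebra.Solver.Ring.AlmostCommutativeRing
    using (AlmostCommutativeRing; _-Raw-AlmostCommutative⟶_)
  import Algebra.Solver.Ring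
  open PolySolver using (solve; _:+_; _:*_; _:-_; :-_; _:=_; con)

  P : ℤ
  P = + p

  1<p : 1 ℕ.< p
  1<p = ℕ.nonTrivial⇒n>1 p {{prime⇒nonTrivial isPrime}}

  P∤1 : ¬ (P Div.∣ 1ℤ)
  P∤1 d = ℕP.<⇒≢ 1<p (sym (ℕD.∣1⇒≡1 (Div.∣⇒∣ᵤ d)))

  euclid : ∀ a b → P Div.∣ (a * b) → P Div.∣ a ⊎ P Div.∣ b
  euclid a b d = Sum.map Div.∣ᵤ⇒∣ Div.∣ᵤ⇒∣
    (euclidsLemma ℤ.∣ a ∣ ℤ.∣ b ∣ isPrime (subst (p ℕD.∣_) (ℤP.abs-* a b) (Div.∣⇒∣ᵤ d)))

  Vanishes : Poly → Set
  Vanishes f = ∀ i → P Div.∣ coeff f i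

  ZeroP⇒vanishes : ∀ f → ZeroP p f → Vanishes f
  ZeroP⇒vanishes [] z i = divides 0ℤ refl
  ZeroP⇒vanishes (a ∷ f) (d ∷ z) zero = Div.∣ᵤ⇒∣ d
  ZeroP⇒vanishes (a ∷ f) (d ∷ z) (suc i) = ZeroP⇒vanishes f z i

  vanishes⇒ZeroP : ∀ f → Vanishes f → ZeroP p f
  vanishes⇒ZeroP [] z = []
  vanishes⇒ZeroP (a ∷ f) z = Div.∣⇒∣ᵤ (z 0) ∷ vanishes⇒ZeroP f (λ i → z (suc i))

  vanishes? : ∀ f → Dec (Vanishes f)
  vanishes? [] = yes (λ i → divides 0ℤ refl)
  vanishes? (a ∷ f) with P Div.∣? a | vanishes? f
  ... | yes pa | yes zf = yes λ { zero → pa ; (suc i) → zf i }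
  ... | no na | _ = no λ z → na (z 0)
  ... | yes _ | no nf = no λ z → nf (λ i → z (suc i))

  nonvanishing-by-coeff : ∀ f i c → coeff f i ≡ c → ¬ (P Div.∣ c) → ¬ Vanishes f
  nonvanishing-by-coeff f i c e p∤c z = p∤c (subst (P Div.∣_) e (z i))

  vanishes-resp : ∀ f g → f ≋ g → Vanishes f → Vanishes g
  vanishes-resp f g e z i = subst (P Div.∣_) (at e i) (z i)

  vanishes-+ : ∀ f g → Vanishes f → Vanishes g → Vanishes (f +P g)
  vanishes-+ f g z z' i = subst (P Div.∣_) (sym (coeff-+ f g i)) (Div.∣m∣n⇒∣m+n (z i) (z' i))

  vanishes-neg : ∀ f → Vanishes f → Vanishes (negP f)
  vanishes-neg f z i = subst (P Div.∣_) (sym (coeff-neg f i)) (Div.∣m⇒∣-m (z i))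

  vanishes-cancel : ∀ f g → Vanishes (f +P g) → Vanishes f → Vanishes g
  vanishes-cancel f g z z' i = Div.∣m+n∣m⇒∣n (subst (P Div.∣_) (coeff-+ f g i) (z i)) (z' i)

  vanishes-*ˡ : ∀ f g → Vanishes f → Vanishes (f *P g)
  vanishes-*ˡ f g z zero = subst (P Div.∣_) (sym (coeff-*-0 f g)) (Div.∣m⇒∣m*n (coeff g 0) (z 0))
  vanishes-*ˡ f g z (suc i) = subst (P Div.∣_) (sym (coeff-*-suc f g i))
    (Div.∣m∣n⇒∣m+n (Div.∣m⇒∣m*n (coeff g (suc i)) (z 0))
      (vanishes-*ˡ (tailP f) g (λ j → subst (P Div.∣_) (sym (coeff-tailP f j)) (z (suc j))) i))

  vanishes-*ʳ : ∀ f g → Vanishes g → Vanishes (f *P g)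
  vanishes-*ʳ f g z = vanishes-resp (g *P f) (f *P g) ⟨ *P-comm g f ⟩ (vanishes-*ˡ g f z)

  vanishes-scale : ∀ c f → P Div.∣ c → Vanishes (scaleP c f)
  vanishes-scale c f d i = subst (P Div.∣_) (sym (coeff-scale c f i)) (Div.∣m⇒∣m*n (coeff f i) d)

  -- F_p[x] has no zero divisors (Euclid's lemma on the lowest coefficients not divisible by p)
  vanishes-* : ∀ f g → Vanishes (f *P g) → Vanishes f ⊎ Vanishes g
  vanishes-* f [] z = inj₂ (λ i → divides 0ℤ refl)
  vanishes-* f (b ∷ g) z with P Div.∣? b
  ... | yes p∣b with vanishes-* f g (λ i → vanishes-cancel (scaleP b f) (+ 0 ∷ (f *P g))
              (vanishes-resp (f *P (b ∷ g)) (scaleP b f +P (+ 0 ∷ (f *P g))) ⟨ *P-cons f b g ⟩ z) (vanishes-scale b f p∣b) (suc i))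
  ... | inj₁ zf = inj₁ zf
  ... | inj₂ zg = inj₂ λ { zero → p∣b ; (suc i) → zg i }
  vanishes-* [] (b ∷ g) z | no p∤b = inj₁ (λ i → divides 0ℤ refl)
  vanishes-* (a ∷ f) (b ∷ g) z | no p∤b with euclid a b (subst (P Div.∣_) (coeff-*-0 (a ∷ f) (b ∷ g)) (z 0))
  ... | inj₂ p∣b = ⊥-elim (p∤b p∣b)
  ... | inj₁ p∣a with vanishes-* f (b ∷ g) (λ i → vanishes-cancel (scaleP a (b ∷ g)) (+ 0 ∷ (f *P (b ∷ g))) z
                                             (vanishes-scale a (b ∷ g) p∣a) (suc i))
  ... | inj₁ zf = inj₁ λ { zero → p∣a ; (suc i) → zf i }
  ... | inj₂ zg = inj₂ zg

  vanishes-self-difference : ∀ f → Vanishes (f -P f)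
  vanishes-self-difference f i = subst (P Div.∣_)
    (sym (trans (coeff-+ f (negP f) i) (trans (cong (λ v → coeff f i ℤ.+ v) (coeff-neg f i)) (ℤP.+-inverseʳ (coeff f i)))))
    (divides 0ℤ refl)

  nonvanishing-* : ∀ f g → ¬ Vanishes f → ¬ Vanishes g → ¬ Vanishes (f *P g)
  nonvanishing-* f g nf ng z = [ nf , ng ]′ (vanishes-* f g z)

  K : Set
  K = Σ RatF (λ r → ¬ Vanishes (den r))

  cross : RatF → RatF → Poly
  cross r s = (num r *P den s) -P (num s *P den r)

  infix 4 _≈K_
  record _≈K_ (x y : K) : Set where
    constructor ⟪_⟫
    field cross-vanishes : Vanishes (cross (proj₁ x) (proj₁ y))
  open _≈K_ public

  infixl 6 _+K_ _-K_
  infixl 7 _*K_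
  infix 8 -K_
  _+K_ : K → K → K
  (r , dr) +K (s , ds) = (r +R s , nonvanishing-* (den r) (den s) dr ds)
  _*K_ : K → K → K
  (r , dr) *K (s , ds) = (r *R s , nonvanishing-* (den r) (den s) dr ds)
  -K_ : K → K
  -K (r , dr) = (-R r , dr)
  _-K_ : K → K → K
  x -K y = x +K (-K y)

  cK : ℤ → K
  cK i = (constR i , λ z → P∤1 (z 0))
  nK : ℕ → K
  nK n = cK (+ n)
  0K 1K : K
  0K = nK 0
  1K = nK 1

  ≈K-byIdentity : ∀ {x y : K} → cross (proj₁ x) (proj₁ y) ≋ constP (+ 0) → x ≈K y
  ≈K-byIdentity {x} {y} e =
    ⟪ vanishes-resp (constP (+ 0)) (cross (proj₁ x) (proj₁ y))
        ⟨ ≐-sym {cross (proj₁ x) (proj₁ y)} {constP (+ 0)} (at e) ⟩ (λ { zero → divides 0ℤ refl ; (suc i) → divides 0ℤ refl }) ⟫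

  ≡⇒≈K : ∀ {x y} → x ≡ y → x ≈K y
  ≡⇒≈K {r , _} refl = ≈K-byIdentity (solve 2 (λ a b → a :* b :- a :* b := con (+ 0)) ≋-refl (num r) (den r))

  ≡₁⇒≈K : ∀ x y → proj₁ x ≡ proj₁ y → x ≈K y
  ≡₁⇒≈K x y eq = ⟪ subst (λ s → Vanishes (cross (proj₁ x) s)) eq (cross-vanishes (≡⇒≈K {x} refl)) ⟫

  K-refl : ∀ {x} → x ≈K x
  K-refl {x} = ≡⇒≈K {x} refl

  K-sym : ∀ {x y} → x ≈K y → y ≈K x
  K-sym {r , _} {s , _} ⟪ z ⟫ = ⟪ vanishes-resp (negP (cross r s)) (cross s r)
    (solve 4 (λ a b c d → :- (a :* d :- c :* b) := c :* b :- a :* d) ≋-refl (num r) (den r) (num s) (den s))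
    (vanishes-neg (cross r s) z) ⟫

  -- transitivity cancels the (nonzero) middle denominator
  K-trans : ∀ {x y z} → x ≈K y → y ≈K z → x ≈K z
  K-trans {r , _} {s , ds} {t , _} ⟪ z₁ ⟫ ⟪ z₂ ⟫ =
    ⟪ [ (λ zd → ⊥-elim (ds zd)) , (λ zc → zc) ]′ (vanishes-* (den s) (cross r t)
      (vanishes-resp ((den t *P cross r s) +P (den r *P cross s t)) (den s *P cross r t)
        (solve 6 (λ a b c d e f → f :* (a :* d :- c :* b) :+ b :* (c :* f :- e :* d) := d :* (a :* f :- e :* b))
           ≋-refl (num r) (den r) (num s) (den s) (num t) (den t))
        (vanishes-+ (den t *P cross r s) (den r *P cross s t)
           (vanishes-*ʳ (den t) (cross r s) z₁) (vanishes-*ʳ (den r) (cross s t) z₂)))) ⟫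

  K-isEquivalence : IsEquivalence _≈K_
  K-isEquivalence = record { refl = K-refl ; sym = K-sym ; trans = K-trans }

  K-setoid : Setoid _ _
  K-setoid = record { Carrier = K ; _≈_ = _≈K_ ; isEquivalence = K-isEquivalence }

  module ≈K-Reasoning = SetoidReasoning K-setoid

  +K-cong : ∀ {x x' y y'} → x ≈K x' → y ≈K y' → (x +K y) ≈K (x' +K y')
  +K-cong {r , _} {r' , _} {s , _} {s' , _} ⟪ z₁ ⟫ ⟪ z₂ ⟫ = ⟪ vanishes-resp
    (((den s *P den s') *P cross r r') +P ((den r *P den r') *P cross s s'))
    (cross (r +R s) (r' +R s'))
    (solve 8 (λ a b c d a' b' c' d' → (d :* d') :* (a :* b' :- a' :* b) :+ (b :* b') :* (c :* d' :- c' :* d)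
                  := (a :* d :+ c :* b) :* (b' :* d') :- (a' :* d' :+ c' :* b') :* (b :* d)) ≋-refl
       (num r) (den r) (num s) (den s) (num r') (den r') (num s') (den s'))
    (vanishes-+ ((den s *P den s') *P cross r r') ((den r *P den r') *P cross s s')
       (vanishes-*ʳ (den s *P den s') (cross r r') z₁) (vanishes-*ʳ (den r *P den r') (cross s s') z₂)) ⟫

  *K-cong : ∀ {x x' y y'} → x ≈K x' → y ≈K y' → (x *K y) ≈K (x' *K y')
  *K-cong {r , _} {r' , _} {s , _} {s' , _} ⟪ z₁ ⟫ ⟪ z₂ ⟫ = ⟪ vanishes-resp
    (((num s *P den s') *P cross r r') +P ((num r' *P den r) *P cross s s'))
    (cross (r *R s) (r' *R s'))
    (solve 8 (λ a b c d a' b' c' d' → (c :* d') :* (a :* b' :- a' :* b) :+ (a' :* b) :* (c :* d' :- c' :* d)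
                  := (a :* c) :* (b' :* d') :- (a' :* c') :* (b :* d)) ≋-refl
       (num r) (den r) (num s) (den s) (num r') (den r') (num s') (den s'))
    (vanishes-+ ((num s *P den s') *P cross r r') ((num r' *P den r) *P cross s s')
       (vanishes-*ʳ (num s *P den s') (cross r r') z₁) (vanishes-*ʳ (num r' *P den r) (cross s s') z₂)) ⟫

  -K-cong : ∀ {x y} → x ≈K y → (-K x) ≈K (-K y)
  -K-cong {r , _} {s , _} ⟪ z ⟫ = ⟪ vanishes-resp (negP (cross r s)) (cross (-R r) (-R s))
    (solve 4 (λ a b c d → :- (a :* d :- c :* b) := (:- a) :* d :- (:- c) :* b) ≋-refl (num r) (den r) (num s) (den s))
    (vanishes-neg (cross r s) z) ⟫

  -- the field laws of K are polynomial identities between numerators and denominators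
  +K-assoc : ∀ x y z → ((x +K y) +K z) ≈K (x +K (y +K z))
  +K-assoc (r , _) (s , _) (t , _) = ≈K-byIdentity (solve 6 (λ a b c d e f →
    ((a :* d :+ c :* b) :* f :+ e :* (b :* d)) :* (b :* (d :* f)) :- (a :* (d :* f) :+ (c :* f :+ e :* d) :* b) :* ((b :* d) :* f)
      := con (+ 0)) ≋-refl (num r) (den r) (num s) (den s) (num t) (den t))

  +K-comm : ∀ x y → (x +K y) ≈K (y +K x)
  +K-comm (r , _) (s , _) = ≈K-byIdentity (solve 4 (λ a b c d →
    (a :* d :+ c :* b) :* (d :* b) :- (c :* b :+ a :* d) :* (b :* d) := con (+ 0)) ≋-refl
    (num r) (den r) (num s) (den s))

  +K-identityˡ : ∀ x → (0K +K x) ≈K x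
  +K-identityˡ (r , _) = ≈K-byIdentity (solve 2 (λ a b →
    (con (+ 0) :* b :+ a :* con (+ 1)) :* b :- a :* (con (+ 1) :* b) := con (+ 0)) ≋-refl (num r) (den r))

  *K-assoc : ∀ x y z → ((x *K y) *K z) ≈K (x *K (y *K z))
  *K-assoc (r , _) (s , _) (t , _) = ≈K-byIdentity (solve 6 (λ a b c d e f →
    ((a :* c) :* e) :* (b :* (d :* f)) :- (a :* (c :* e)) :* ((b :* d) :* f) := con (+ 0)) ≋-refl
    (num r) (den r) (num s) (den s) (num t) (den t))

  *K-comm : ∀ x y → (x *K y) ≈K (y *K x)
  *K-comm (r , _) (s , _) = ≈K-byIdentity (solve 4 (λ a b c d →
    (a :* c) :* (d :* b) :- (c :* a) :* (b :* d) := con (+ 0)) ≋-refl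
    (num r) (den r) (num s) (den s))

  *K-identityˡ : ∀ x → (1K *K x) ≈K x
  *K-identityˡ (r , _) = ≈K-byIdentity (solve 2 (λ a b →
    (con (+ 1) :* a) :* b :- a :* (con (+ 1) :* b) := con (+ 0)) ≋-refl (num r) (den r))

  K-distribʳ : ∀ x y z → ((y +K z) *K x) ≈K ((y *K x) +K (z *K x))
  K-distribʳ (r , _) (s , _) (t , _) = ≈K-byIdentity (solve 6 (λ a b c d e f →
    ((c :* f :+ e :* d) :* a) :* ((d :* b) :* (f :* b)) :- ((c :* a) :* (f :* b) :+ (e :* a) :* (d :* b)) :* ((d :* f) :* b)
      := con (+ 0)) ≋-refl (num r) (den r) (num s) (den s) (num t) (den t))

  K-zeroˡ : ∀ x → (0K *K x) ≈K 0K
  K-zeroˡ (r , _) = ≈K-byIdentity (solve 2 (λ a b →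
    (con (+ 0) :* a) :* con (+ 1) :- con (+ 0) :* (con (+ 1) :* b) := con (+ 0)) ≋-refl (num r) (den r))

  K-neg-*ˡ : ∀ x y → ((-K x) *K y) ≈K (-K (x *K y))
  K-neg-*ˡ (r , _) (s , _) = ≈K-byIdentity (solve 4 (λ a b c d →
    ((:- a) :* c) :* (b :* d) :- (:- (a :* c)) :* (b :* d) := con (+ 0)) ≋-refl
    (num r) (den r) (num s) (den s))

  K-neg-+ : ∀ x y → ((-K x) +K (-K y)) ≈K (-K (x +K y))
  K-neg-+ (r , _) (s , _) = ≈K-byIdentity (solve 4 (λ a b c d →
    ((:- a) :* d :+ (:- c) :* b) :* (b :* d) :- (:- (a :* d :+ c :* b)) :* (b :* d) := con (+ 0)) ≋-refl
    (num r) (den r) (num s) (den s))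

  module KLaws = AlmostCommutativeRingFromLaws.Build _≈K_ _+K_ _*K_ -K_ 0K 1K K-isEquivalence
    (λ {x} {y} {u} {v} → +K-cong {x} {y} {u} {v})
    (λ {x} {y} {u} {v} → *K-cong {x} {y} {u} {v})
    +K-assoc +K-comm +K-identityˡ *K-assoc *K-comm *K-identityˡ K-distribʳ K-zeroˡ
    (λ {x} {y} → -K-cong {x} {y}) K-neg-*ˡ K-neg-+

  cK-+ : ∀ i j → cK (i ℤ.+ j) ≈K (cK i +K cK j)
  cK-+ i j = ≈K-byIdentity (solve 2 (λ I J →
    (I :+ J) :* (con (+ 1) :* con (+ 1)) :- (I :* con (+ 1) :+ J :* con (+ 1)) :* con (+ 1) := con (+ 0))
    ≋-refl (constP i) (constP j))

  cK-* : ∀ i j → cK (i * j) ≈K (cK i *K cK j)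
  cK-* i j = ⟪ vanishes-resp (constP (i * j) -P constP (i * j)) (cross (constR (i * j)) (constR i *R constR j))
     (IsEquivalence.trans ≋-isEquivalence
        ⟨ +P-cong {constP (i * j)} {constP (i * j)} {negP (constP (i * j))} {negP (constP i *P constP j)}
            (λ _ → refl) (negP-cong {constP (i * j)} {constP i *P constP j} (constP-* i j)) ⟩
        (solve 3 (λ X I J → X :- I :* J := X :* (con (+ 1) :* con (+ 1)) :- (I :* J) :* con (+ 1)) ≋-refl
           (constP (i * j)) (constP i) (constP j)))
     (vanishes-self-difference (constP (i * j))) ⟫

  kRing : AlmostCommutativeRing _ _
  kRing = KLaws.ring

  cK-hom : ℤ-rawRing -Raw-AlmostCommutative⟶ kRing
  cK-hom = record
    { ⟦_⟧ = cK ; +-homo = cK-+ ; *-homo = cK-*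
    ; -‿homo = λ i → K-refl ; 0-homo = K-refl ; 1-homo = K-refl }

  cK-≟ : ∀ i j → Maybe (cK i ≈K cK j)
  cK-≟ i j with i ℤP.≟ j
  ... | yes refl = just K-refl
  ... | no _ = nothing

  module KSolver = Algebra.Solver.Ring ℤ-rawRing kRing cK-hom cK-≟

  nK-suc : ∀ n → nK (suc n) ≈K (1K +K nK n)
  nK-suc n = cK-+ (+ 1) (+ n)

  p≈0 : nK p ≈K 0K
  p≈0 = ⟪ vanishes-resp (constP (+ p)) (cross (natR p) (natR 0))
     (solve 1 (λ X → X := X :* con (+ 1) :- con (+ 0) :* con (+ 1)) ≋-refl (constP (+ p)))
     (λ { zero → Div.∣-refl ; (suc i) → divides 0ℤ refl }) ⟫

  Nonzero : K → Set
  Nonzero x = ¬ Vanishes (num (proj₁ x))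

  -- the inverse, made total by 0⁻¹ = 0; on nonzero elements it is the fraction inverse invR
  inv : K → K
  inv (r , _) with vanishes? (num r)
  ... | yes _ = 0K
  ... | no nz = (invR r , nz)

  inv-underlying : ∀ x → Nonzero x → proj₁ (inv x) ≡ invR (proj₁ x)
  inv-underlying (r , _) nz with vanishes? (num r)
  ... | yes z = ⊥-elim (nz z)
  ... | no _ = refl

  nonzero-resp : ∀ {x y} → x ≈K y → Nonzero x → Nonzero y
  nonzero-resp {r , _} {s , ds} ⟪ z ⟫ nr zs =
    [ nr , ds ]′ (vanishes-* (num r) (den s) (vanishes-resp (cross r s +P (num s *P den r)) (num r *P den s)
       (solve 2 (λ u v → u :- v :+ v := u) ≋-refl (num r *P den s) (num s *P den r))
       (vanishes-+ (cross r s) (num s *P den r) z (vanishes-*ˡ (num s) (den r) zs))))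

  inv-cong : ∀ {x y} → x ≈K y → inv x ≈K inv y
  inv-cong {r , dr} {s , ds} e with vanishes? (num r) | vanishes? (num s)
  ... | yes _ | yes _ = K-refl
  ... | yes zr | no ns = ⊥-elim (nonzero-resp {s , ds} {r , dr} (K-sym e) ns zr)
  ... | no nr | yes zs = ⊥-elim (nonzero-resp {r , dr} {s , ds} e nr zs)
  ... | no nr | no ns = ⟪ vanishes-resp (negP (cross r s)) (cross (invR r) (invR s))
        (solve 4 (λ a b c d → :- (a :* d :- c :* b) := b :* c :- d :* a) ≋-refl (num r) (den r) (num s) (den s))
        (vanishes-neg (cross r s) (cross-vanishes e)) ⟫

  *K-inverseʳ : ∀ x → Nonzero x → (x *K inv x) ≈K 1K
  *K-inverseʳ (r , _) nz with vanishes? (num r)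
  ... | yes z = ⊥-elim (nz z)
  ... | no _ = ≈K-byIdentity (solve 2 (λ a b → (a :* b) :* con (+ 1) :- con (+ 1) :* (b :* a) := con (+ 0))
                 ≋-refl (num r) (den r))

  nonzero-* : ∀ x y → Nonzero x → Nonzero y → Nonzero (x *K y)
  nonzero-* (r , _) (s , _) = nonvanishing-* (num r) (num s)

  inv-* : ∀ x y → Nonzero x → Nonzero y → inv (x *K y) ≈K (inv x *K inv y)
  inv-* x y nx ny = ≡₁⇒≈K (inv (x *K y)) (inv x *K inv y)
    (trans (inv-underlying (x *K y) (nonzero-* x y nx ny))
           (sym (cong₂ _*R_ (inv-underlying x nx) (inv-underlying y ny))))

  nonzero-neg : ∀ x → Nonzero x → Nonzero (-K x)
  nonzero-neg (r , _) nz z = nz λ i → subst (P Div.∣_) (ℤP.neg-involutive (coeff (num r) i))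
    (Div.∣m⇒∣-m (subst (P Div.∣_) (coeff-neg (num r) i) (z i)))

  inv-neg : ∀ x → Nonzero x → inv (-K x) ≈K (-K inv x)
  inv-neg x@(r , dr) nx = begin
      inv (-K x)
    ≈⟨ ≡₁⇒≈K (inv (-K x)) (invR (-R r) , nonzero-neg x nx) (inv-underlying (-K x) (nonzero-neg x nx)) ⟩
      (invR (-R r) , nonzero-neg x nx)
    ≈⟨ ≈K-byIdentity (solve 2 (λ a b → b :* a :- (:- b) :* (:- a) := con (+ 0)) ≋-refl (num r) (den r)) ⟩
      (-R invR r , nx)
    ≈⟨ ≡₁⇒≈K (-R invR r , nx) (-K inv x) (cong -R_ (sym (inv-underlying x nx))) ⟩
      -K inv x
    ∎ where open ≈K-Reasoning

  transfer : ∀ (u v : K) {r s : RatF} → r ≡ proj₁ u → s ≡ proj₁ v → u ≈K v →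
    WellDefined p r × WellDefined p s × r ≈[ p ] s
  transfer (r , dr) (s , ds) refl refl ⟪ z ⟫ =
    (λ d → dr (ZeroP⇒vanishes (den r) d)) , (λ d → ds (ZeroP⇒vanishes (den s) d)) , vanishes⇒ZeroP (cross r s) z

module FieldIdentities (p : ℕ) (isPrime : Prime p) where

  open FractionField p isPrime
  open KSolver using (_:*_; _:=_; con)
  open import Data.Integer using (+_)

  inv-of-negative : ∀ a b → Nonzero b → a ≈K (-K b) → inv a ≈K (-K inv b)
  inv-of-negative a b nb e = K-trans {inv a} {inv (-K b)} (inv-cong {a} { -K b} e) (inv-neg b nb)

  cancel-square : ∀ y F → Nonzero y → ((y *K y) *K (inv (y *K y) *K F)) ≈K F
  cancel-square y F ny = begin
      (y *K y) *K (inv (y *K y) *K F)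
    ≈⟨ *K-cong {y *K y} K-refl (*K-cong {inv (y *K y)} {i *K i} {F} (inv-* y y ny ny) K-refl) ⟩
      (y *K y) *K ((i *K i) *K F)
    ≈⟨ KSolver.solve 3 (λ y i F → (y :* y) :* ((i :* i) :* F) := (y :* i) :* ((y :* i) :* F)) K-refl y i F ⟩
      (y *K i) *K ((y *K i) *K F)
    ≈⟨ *K-cong {y *K i} {1K} (*K-inverseʳ y ny) (*K-cong {y *K i} {1K} {F} (*K-inverseʳ y ny) K-refl) ⟩
      1K *K (1K *K F)
    ≈⟨ KSolver.solve 1 (λ F → con (+ 1) :* (con (+ 1) :* F) := F) K-refl F ⟩
      F
    ∎ where
      open ≈K-Reasoning
      i = inv y

  cancel-square-inv : ∀ y u F → Nonzero y → Nonzero u → (inv y *K ((y *K y) *K (inv (u *K y) *K F))) ≈K (inv u *K F)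
  cancel-square-inv y u F ny nu = begin
      i *K ((y *K y) *K (inv (u *K y) *K F))
    ≈⟨ *K-cong {i} K-refl (*K-cong {y *K y} K-refl (*K-cong {inv (u *K y)} {j *K i} {F} (inv-* u y nu ny) K-refl)) ⟩
      i *K ((y *K y) *K ((j *K i) *K F))
    ≈⟨ KSolver.solve 4 (λ y i j F → i :* ((y :* y) :* ((j :* i) :* F)) := (y :* i) :* ((y :* i) :* (j :* F)))
         K-refl y i j F ⟩
      (y *K i) *K ((y *K i) *K (j *K F))
    ≈⟨ *K-cong {y *K i} {1K} (*K-inverseʳ y ny) (*K-cong {y *K i} {1K} {j *K F} (*K-inverseʳ y ny) K-refl) ⟩
      1K *K (1K *K (j *K F))
    ≈⟨ KSolver.solve 1 (λ F → con (+ 1) :* (con (+ 1) :* F) := F) K-refl (j *K F) ⟩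
      j *K F
    ∎ where
      open ≈K-Reasoning
      i = inv y
      j = inv u


  negate-factor : ∀ i u c → i ≈K (-K u) → (u *K c) ≈K (-K (i *K c))
  negate-factor i u c e = K-trans {u *K c} { -K ((-K u) *K c)} { -K (i *K c)}
    (KSolver.solve 2 (λ u c → u :* c := KSolver.:- ((KSolver.:- u) :* c)) K-refl u c)
    (-K-cong {(-K u) *K c} {i *K c} (*K-cong { -K u} {i} {c} (K-sym {i} { -K u} e) K-refl))

module MultipleSums (p : ℕ) (isPrime : Prime p) where

  open FractionField p isPrime
  open KSolver using (solve; _:+_; _:*_; _:-_; :-_; _:=_; con)
  open import Data.Nat using (zero; _∸_; _<_)
  import Data.Nat as ℕ
  import Data.Nat.Properties as ℕP
  open import Data.Integer using (+_)
  open import Data.List using (List; []; _∷_; map; upTo; applyUpTo; _++_; foldr)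
  import Data.List.Properties as LP
  open import Data.List.Relation.Unary.All as All using (All; []; _∷_)
  import Data.List.Relation.Unary.All.Properties as AllP
  open import Data.List.Relation.Binary.Pointwise using (Pointwise; []; _∷_)
  open import Function using (_∘_; id)
  open import Relation.Binary.PropositionalEquality

  above-snoc : ∀ q lo → lo < q → above (suc q) lo ≡ above q lo ++ q ∷ []
  above-snoc q lo lo<q = begin
      map (suc lo ℕ.+_) (upTo (suc q ∸ suc lo))
    ≡⟨ cong (map (suc lo ℕ.+_) ∘ upTo) (ℕP.+-∸-assoc 1 lo<q) ⟩
      map (suc lo ℕ.+_) (upTo (suc k))
    ≡⟨ cong (map (suc lo ℕ.+_)) (sym (LP.upTo-∷ʳ k)) ⟩
      map (suc lo ℕ.+_) (upTo k ++ k ∷ [])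
    ≡⟨ LP.map-++ (suc lo ℕ.+_) (upTo k) (k ∷ []) ⟩
      above q lo ++ suc lo ℕ.+ k ∷ []
    ≡⟨ cong (λ n → above q lo ++ n ∷ []) (ℕP.m+[n∸m]≡n lo<q) ⟩
      above q lo ++ q ∷ []
    ∎ where
      open ≡-Reasoning
      k = q ∸ suc lo

  above-first : ∀ q → 1 < q → above q 0 ≡ 1 ∷ above q 1
  above-first q 1<q = begin
      map (1 ℕ.+_) (upTo (q ∸ 1))                   ≡⟨ cong (map (1 ℕ.+_) ∘ upTo) (ℕP.+-∸-assoc 1 1<q) ⟩
      map (1 ℕ.+_) (upTo (suc k))                   ≡⟨⟩
      1 ∷ map (1 ℕ.+_) (applyUpTo suc k)            ≡⟨ cong (1 ∷_) (LP.map-applyUpTo suc (1 ℕ.+_) k) ⟩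
      1 ∷ applyUpTo (λ i → suc (suc i)) k          ≡⟨ cong (1 ∷_) (sym (LP.map-applyUpTo id (2 ℕ.+_) k)) ⟩
      1 ∷ above q 1                                 ∎
    where
      open ≡-Reasoning
      k = q ∸ 2

  above-shift : ∀ q lo → map suc (above q lo) ≡ above (suc q) (suc lo)
  above-shift q lo = sym (LP.map-∘ (upTo (q ∸ suc lo)))

  above-empty : ∀ q → above (suc q) q ≡ []
  above-empty q = cong (map (suc q ℕ.+_) ∘ upTo) (ℕP.n∸n≡0 q)

  above-bounded : ∀ {P : ℕ → Set} q lo → (∀ n → n < q → P n) → All P (above q lo)
  above-bounded q lo H = AllP.map⁺ (AllP.applyUpTo⁺₁ id (q ∸ suc lo) (λ {i} i<k → H _ (bound lo q i i<k)))
    where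
      bound : ∀ lo q i → i < q ∸ suc lo → suc lo ℕ.+ i < q
      bound zero (suc q) i h = ℕ.s≤s h
      bound (suc lo) (suc q) i h = ℕ.s≤s (bound lo q i h)

  sumK : List K → K
  sumK = foldr _+K_ 0K

  sum-++ : ∀ xs ys → sumK (xs ++ ys) ≈K (sumK xs +K sumK ys)
  sum-++ [] ys = K-sym (+K-identityˡ (sumK ys))
  sum-++ (x ∷ xs) ys = K-trans {x +K sumK (xs ++ ys)} {x +K (sumK xs +K sumK ys)}
    (+K-cong {x} K-refl (sum-++ xs ys)) (K-sym (+K-assoc x (sumK xs) (sumK ys)))

  sum-cong : ∀ {A : Set} (F G : A → K) {xs} → All (λ n → F n ≈K G n) xs → sumK (map F xs) ≈K sumK (map G xs)
  sum-cong F G [] = K-refl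
  sum-cong F G {n ∷ _} (e ∷ es) = +K-cong {F n} {G n} e (sum-cong F G es)

  sum-linear : ∀ {A : Set} (F G : A → K) (k : K) xs →
    sumK (map (λ n → F n +K (G n *K k)) xs) ≈K (sumK (map F xs) +K (sumK (map G xs) *K k))
  sum-linear F G k [] = solve 1 (λ k → con (+ 0) := con (+ 0) :+ con (+ 0) :* k) K-refl k
  sum-linear F G k (n ∷ xs) = K-trans {(F n +K (G n *K k)) +K sumK (map (λ n → F n +K (G n *K k)) xs)}
    (+K-cong {F n +K (G n *K k)} K-refl (sum-linear F G k xs))
    (solve 5 (λ a b k sa sb → (a :+ b :* k) :+ (sa :+ sb :* k) := (a :+ sa) :+ (b :+ sb) :* k)
       K-refl (F n) (G n) k (sumK (map F xs)) (sumK (map G xs)))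

  sum-above-snoc : ∀ (F : ℕ → K) q lo → lo < q →
    sumK (map F (above (suc q) lo)) ≈K (sumK (map F (above q lo)) +K F q)
  sum-above-snoc F q lo lo<q = begin
      sumK (map F (above (suc q) lo))
    ≡⟨ cong (sumK ∘ map F) (above-snoc q lo lo<q) ⟩
      sumK (map F (above q lo ++ q ∷ []))
    ≡⟨ cong sumK (LP.map-++ F (above q lo) (q ∷ [])) ⟩
      sumK (map F (above q lo) ++ F q ∷ [])
    ≈⟨ sum-++ (map F (above q lo)) (F q ∷ []) ⟩
      sumK (map F (above q lo)) +K (F q +K 0K)
    ≈⟨ solve 2 (λ s f → s :+ (f :+ con (+ 0)) := s :+ f) K-refl (sumK (map F (above q lo))) (F q) ⟩
      sumK (map F (above q lo)) +K F q
    ∎ where open ≈K-Reasoning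

  -- f_q^lo(z₁,…,zₘ) in K; for q = p it computes fFrom (Specialisation.msum-underlying)
  msum : ℕ → ℕ → List K → K
  msum q lo [] = 1K
  msum q lo (z ∷ zs) = sumK (map (λ n → inv (nK n -K z) *K msum q n zs) (above q lo))

  msum-cong : ∀ q lo {zs ws} → Pointwise _≈K_ zs ws → msum q lo zs ≈K msum q lo ws
  msum-cong q lo [] = K-refl
  msum-cong q lo {z ∷ zs} {w ∷ ws} (e ∷ es) = sum-cong _ _ (All.universal (λ n →
    *K-cong {inv (nK n -K z)} {inv (nK n -K w)}
      (inv-cong {nK n -K z} {nK n -K w} (+K-cong {nK n} {nK n} K-refl (-K-cong {z} {w} e)))
      (msum-cong q n es)) (above q lo))

  msum-beyond : ∀ q l z → msum (suc q) q (l ++ z ∷ []) ≡ 0K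
  msum-beyond q [] z = cong (sumK ∘ map _) (above-empty q)
  msum-beyond q (y ∷ l) z = cong (sumK ∘ map _) (above-empty q)

  msum-snoc : ∀ l z q lo → lo < q →
    msum (suc q) lo (l ++ z ∷ []) ≈K (msum q lo (l ++ z ∷ []) +K (msum q lo l *K inv (nK q -K z)))
  msum-snoc [] z q lo lo<q = begin
      sumK (map T (above (suc q) lo))
    ≈⟨ sum-above-snoc T q lo lo<q ⟩
      sumK (map T (above q lo)) +K T q
    ≈⟨ solve 2 (λ s i → s :+ i :* con (+ 1) := s :+ con (+ 1) :* i) K-refl (sumK (map T (above q lo))) (inv (nK q -K z)) ⟩
      sumK (map T (above q lo)) +K (1K *K inv (nK q -K z))
    ∎ where
      open ≈K-Reasoning
      T : ℕ → K
      T n = inv (nK n -K z) *K 1K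
  msum-snoc (y ∷ l) z q lo lo<q = begin
      sumK (map T (above (suc q) lo))
    ≈⟨ sum-above-snoc T q lo lo<q ⟩
      sumK (map T (above q lo)) +K T q
    ≈⟨ +K-cong {sumK (map T (above q lo))} K-refl top-vanishes ⟩
      sumK (map T (above q lo)) +K 0K
    ≈⟨ KLaws.+-idʳ _ ⟩
      sumK (map T (above q lo))
    ≈⟨ sum-cong T (λ n → F n +K (G n *K iq)) (above-bounded q lo (λ n n<q →
         K-trans {T n} {inv (nK n -K y) *K (msum q n (l ++ z ∷ []) +K (msum q n l *K iq))}
           (*K-cong {inv (nK n -K y)} K-refl (msum-snoc l z q n n<q))
           (solve 4 (λ i a b k → i :* (a :+ b :* k) := i :* a :+ (i :* b) :* k) K-refl
              (inv (nK n -K y)) (msum q n (l ++ z ∷ [])) (msum q n l) iq))) ⟩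
      sumK (map (λ n → F n +K (G n *K iq)) (above q lo))
    ≈⟨ sum-linear F G iq (above q lo) ⟩
      sumK (map F (above q lo)) +K (sumK (map G (above q lo)) *K iq)
    ∎ where
      open ≈K-Reasoning
      T F G : ℕ → K
      T n = inv (nK n -K y) *K msum (suc q) n (l ++ z ∷ [])
      F n = inv (nK n -K y) *K msum q n (l ++ z ∷ [])
      G n = inv (nK n -K y) *K msum q n l
      iq : K
      iq = inv (nK q -K z)
      top-vanishes : T q ≈K 0K
      top-vanishes = K-trans {T q} {inv (nK q -K y) *K 0K}
        (*K-cong {inv (nK q -K y)} K-refl (≡⇒≈K (msum-beyond q l z)))
        (solve 1 (λ i → i :* con (+ 0) := con (+ 0)) K-refl (inv (nK q -K y)))

  msum-first : ∀ q → 1 < q → ∀ z l → msum q 0 (z ∷ l) ≈K ((inv (nK 1 -K z) *K msum q 1 l) +K msum q 1 (z ∷ l))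
  msum-first q 1<q z l = ≡⇒≈K (cong (sumK ∘ map (λ n → inv (nK n -K z) *K msum q n l)) (above-first q 1<q))

  msum-shift : ∀ q lo zs → msum q lo (map (_-K 1K) zs) ≈K msum (suc q) (suc lo) zs
  msum-shift q lo [] = K-refl
  msum-shift q lo (z ∷ zs) = begin
      sumK (map T (above q lo))
    ≈⟨ sum-cong T (T' ∘ suc) (All.universal (λ n →
         *K-cong {inv (nK n -K (z -K 1K))} {inv (nK (suc n) -K z)}
           (inv-cong {nK n -K (z -K 1K)} {nK (suc n) -K z}
              (K-trans {nK n -K (z -K 1K)} {(1K +K nK n) -K z}
                (solve 2 (λ n z → n :- (z :- con (+ 1)) := (con (+ 1) :+ n) :- z) K-refl (nK n) z)
                (+K-cong {1K +K nK n} {nK (suc n)} (K-sym (nK-suc n)) (K-refl { -K z}))))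
           (msum-shift q n zs)) (above q lo)) ⟩
      sumK (map (T' ∘ suc) (above q lo))
    ≡⟨ cong sumK (trans (LP.map-∘ (above q lo)) (cong (map T') (above-shift q lo))) ⟩
      sumK (map T' (above (suc q) (suc lo)))
    ∎ where
      open ≈K-Reasoning
      T T' : ℕ → K
      T n = inv (nK n -K (z -K 1K)) *K msum q n (map (_-K 1K) zs)
      T' n = inv (nK n -K z) *K msum (suc q) n zs

  boundary : ∀ q → 1 < q → ∀ z₁ rest init zₘ → z₁ ∷ rest ≡ init ++ zₘ ∷ [] →
    (msum (suc q) 1 (z₁ ∷ rest) -K msum q 0 (z₁ ∷ rest))
      ≈K ((inv (nK q -K zₘ) *K msum q 0 init) -K (inv (nK 1 -K z₁) *K msum (suc q) 1 rest))
  boundary q 1<q z .[] [] .z refl = begin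
      msum (suc q) 1 (z ∷ []) -K msum q 0 (z ∷ [])
    ≈⟨ +K-cong {msum (suc q) 1 (z ∷ [])} {C +K (1K *K iq)} (msum-snoc [] z q 1 1<q)
         (-K-cong {msum q 0 (z ∷ [])} {(i₁ *K 1K) +K C} (msum-first q 1<q z [])) ⟩
      (C +K (1K *K iq)) -K ((i₁ *K 1K) +K C)
    ≈⟨ solve 3 (λ C i₁ iq → (C :+ con (+ 1) :* iq) :- (i₁ :* con (+ 1) :+ C) := iq :* con (+ 1) :- i₁ :* con (+ 1))
         K-refl C i₁ iq ⟩
      (iq *K 1K) -K (i₁ *K 1K)
    ∎ where
      open ≈K-Reasoning
      C i₁ iq : K
      C = msum q 1 (z ∷ [])
      i₁ = inv (nK 1 -K z)
      iq = inv (nK q -K z)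
  boundary q 1<q z₁ .(mid ++ zₘ ∷ []) (.z₁ ∷ mid) zₘ refl = begin
      msum (suc q) 1 ((z₁ ∷ mid) ++ zₘ ∷ []) -K msum q 0 (z₁ ∷ (mid ++ zₘ ∷ []))
    ≈⟨ +K-cong {msum (suc q) 1 ((z₁ ∷ mid) ++ zₘ ∷ [])} {C +K (Y *K iq)} (msum-snoc (z₁ ∷ mid) zₘ q 1 1<q)
         (-K-cong {msum q 0 (z₁ ∷ (mid ++ zₘ ∷ []))} {(i₁ *K R) +K C} (msum-first q 1<q z₁ (mid ++ zₘ ∷ []))) ⟩
      (C +K (Y *K iq)) -K ((i₁ *K R) +K C)
    ≈⟨ solve 6 (λ C Y R M i₁ iq → (C :+ Y :* iq) :- (i₁ :* R :+ C)
                 := iq :* (i₁ :* M :+ Y) :- i₁ :* (R :+ M :* iq)) K-refl C Y R M i₁ iq ⟩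
      (iq *K ((i₁ *K M) +K Y)) -K (i₁ *K (R +K (M *K iq)))
    ≈⟨ +K-cong {iq *K ((i₁ *K M) +K Y)} {iq *K msum q 0 (z₁ ∷ mid)}
         (*K-cong {iq} K-refl (K-sym (msum-first q 1<q z₁ mid)))
         (-K-cong {i₁ *K (R +K (M *K iq))} (*K-cong {i₁} K-refl (K-sym (msum-snoc mid zₘ q 1 1<q)))) ⟩
      (iq *K msum q 0 (z₁ ∷ mid)) -K (i₁ *K msum (suc q) 1 (mid ++ zₘ ∷ []))
    ∎ where
      open ≈K-Reasoning
      C Y R M i₁ iq : K
      C = msum q 1 (z₁ ∷ (mid ++ zₘ ∷ []))
      Y = msum q 1 (z₁ ∷ mid)
      R = msum q 1 (mid ++ zₘ ∷ [])
      M = msum q 1 mid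
      i₁ = inv (nK 1 -K z₁)
      iq = inv (nK q -K zₘ)

module ArgumentLists where

  open import Data.Nat using (zero)
  open import Data.List using (List; []; _∷_; map; replicate; _++_)
  import Data.List.Properties as LP
  open import Data.List.Relation.Unary.All using (All; _∷_)
  import Data.List.Relation.Unary.All.Properties as AllP
  open import Data.Product using (_,_)
  open import Relation.Binary.PropositionalEquality

  args : {A : Set} → A → A → ℕ → ℕ → List A
  args u v a b = replicate a v ++ u ∷ replicate b v

  replicate-snoc : ∀ {A : Set} n (v : A) → replicate (suc n) v ≡ replicate n v ++ v ∷ []
  replicate-snoc zero v = refl
  replicate-snoc (suc n) v = cong (v ∷_) (replicate-snoc n v)

  args-snoc : ∀ {A : Set} (u v : A) a b → args u v a (suc b) ≡ args u v a b ++ v ∷ []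
  args-snoc u v a b = trans (cong (λ l → replicate a v ++ u ∷ l) (replicate-snoc b v))
    (sym (LP.++-assoc (replicate a v) (u ∷ replicate b v) (v ∷ [])))

  map-args : ∀ {A B : Set} (f : A → B) (u v : A) a b → map f (args u v a b) ≡ args (f u) (f v) a b
  map-args f u v a b = trans (LP.map-++ f (replicate a v) (u ∷ replicate b v))
    (cong₂ (λ l r → l ++ f u ∷ r) (LP.map-replicate f a v) (LP.map-replicate f b v))

  all-args : ∀ {A : Set} {P : A → Set} {u v : A} a b → P u → P v → All P (args u v a b)
  all-args a b pu pv = AllP.++⁺ (AllP.replicate⁺ a pv) (pu ∷ AllP.replicate⁺ b pv)

  splitLast-snoc : ∀ y m l → splitLast y (m ++ l ∷ []) ≡ (y ∷ m , l)
  splitLast-snoc y [] l = refl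
  splitLast-snoc y (z ∷ m) l rewrite splitLast-snoc z m l = refl

  fTilde-ends : ∀ p y₀ mid yₗ → fTilde p (y₀ ∷ mid ++ yₗ ∷ []) ≡ invR (y₀ *R yₗ) *R fF p mid
  fTilde-ends p y₀ [] yₗ = refl
  fTilde-ends p y₀ (m ∷ ms) yₗ rewrite splitLast-snoc m ms yₗ = refl

module Specialisation (p : ℕ) (isPrime : Prime p) (p≢2 : p ≢ 2) where

  open FractionField p isPrime
  open FieldIdentities p isPrime
  open MultipleSums p isPrime
  open ArgumentLists
  open KSolver using (solve; _:+_; _:*_; _:-_; :-_; _:=_; con)
  open import Data.Nat using (zero)
  import Data.Nat.Properties as ℕP
  import Data.Nat.Divisibility as ℕD
  open import Data.Integer using (+_)
  import Data.Integer as ℤ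
  import Data.Integer.Divisibility.Signed as Div
  open import Data.List using (List; []; _∷_; map; replicate; _++_)
  import Data.List.Properties as LP
  open import Data.List.Relation.Unary.All using (All; []; _∷_)
  import Data.List.Relation.Unary.All.Properties as AllP
  import Data.List.Relation.Binary.Pointwise as Pw
  open import Data.Product using (_,_; proj₁)
  open import Function using (_∘_)
  open import Relation.Nullary using (¬_)
  open import Relation.Binary.PropositionalEquality

  -- z differs from every integer, so all denominators n - z of f(…, z, …) are nonzero
  AvoidsIntegers : K → Set
  AvoidsIntegers z = ∀ n → Nonzero (nK n -K z)

  sumK-underlying : ∀ L → proj₁ (sumK L) ≡ sumR (map proj₁ L)
  sumK-underlying [] = refl
  sumK-underlying (x ∷ L) = cong (proj₁ x +R_) (sumK-underlying L)

  msum-underlying : ∀ lo zs → All AvoidsIntegers zs → proj₁ (msum p lo zs) ≡ fFrom p lo (map proj₁ zs)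
  msum-underlying lo [] [] = refl
  msum-underlying lo (z ∷ zs) (az ∷ azs) = begin
      proj₁ (sumK (map T (above p lo)))
    ≡⟨ sumK-underlying (map T (above p lo)) ⟩
      sumR (map proj₁ (map T (above p lo)))
    ≡⟨ cong sumR (sym (LP.map-∘ (above p lo))) ⟩
      sumR (map (proj₁ ∘ T) (above p lo))
    ≡⟨ cong sumR (LP.map-cong (λ n → cong₂ _*R_ (inv-underlying (nK n -K z) (az n)) (msum-underlying n zs azs)) (above p lo)) ⟩
      sumR (map (λ n → invR (natR n -R proj₁ z) *R fFrom p n (map proj₁ zs)) (above p lo))
    ∎ where
      open ≡-Reasoning
      T : ℕ → K
      T n = inv (nK n -K z) *K msum p n zs

  tilde-underlying : ∀ (y u v : K) A B y₀ yₗ mid → args u v A B ≡ y₀ ∷ mid ++ yₗ ∷ [] →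
    Nonzero (y₀ *K yₗ) → All AvoidsIntegers mid →
    (proj₁ y *R proj₁ y) *R fTilde p (args (proj₁ u) (proj₁ v) A B)
      ≡ proj₁ ((y *K y) *K (inv (y₀ *K yₗ) *K msum p 0 mid))
  tilde-underlying y u v A B y₀ yₗ mid ends nz avoid = cong ((proj₁ y *R proj₁ y) *R_) (begin
      fTilde p (args (proj₁ u) (proj₁ v) A B)
    ≡⟨ cong (fTilde p) (trans (sym (map-args proj₁ u v A B)) (cong (map proj₁) ends)) ⟩
      fTilde p (proj₁ y₀ ∷ map proj₁ (mid ++ yₗ ∷ []))
    ≡⟨ cong (λ l → fTilde p (proj₁ y₀ ∷ l)) (LP.map-++ proj₁ mid (yₗ ∷ [])) ⟩
      fTilde p (proj₁ y₀ ∷ map proj₁ mid ++ proj₁ yₗ ∷ [])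
    ≡⟨ fTilde-ends p (proj₁ y₀) (map proj₁ mid) (proj₁ yₗ) ⟩
      invR (proj₁ y₀ *R proj₁ yₗ) *R fF p (map proj₁ mid)
    ≡⟨ cong₂ _*R_ (sym (inv-underlying (y₀ *K yₗ) nz)) (sym (msum-underlying 0 mid avoid)) ⟩
      proj₁ (inv (y₀ *K yₗ)) *R proj₁ (msum p 0 mid)
    ∎)
    where open ≡-Reasoning

  xK tK wK 2tK : K
  xK = (X , λ z → P∤1 (z 0))
  tK = xK -K 1K
  wK = (nK 2 *K xK) -K 1K
  2tK = nK 2 *K tK

  P∤2 : ¬ (P Div.∣ + 2)
  P∤2 d = p≢2 (ℕP.≤-antisym (ℕD.∣⇒≤ (Div.∣⇒∣ᵤ d)) 1<p)

  -- each of them is a polynomial of degree one whose x-coefficient (±1 or ±2) is a unit mod p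
  x≢0 : Nonzero xK
  x≢0 = nonvanishing-by-coeff (num X) 1 (+ 1) refl P∤1
  t≢0 : Nonzero tK
  t≢0 = nonvanishing-by-coeff (num (proj₁ tK)) 1 (+ 1) refl P∤1
  w≢0 : Nonzero wK
  w≢0 = nonvanishing-by-coeff (num (proj₁ wK)) 1 (+ 2) refl P∤2
  2t≢0 : Nonzero 2tK
  2t≢0 = nonvanishing-by-coeff (num (proj₁ 2tK)) 1 (+ 2) refl P∤2

  x-avoids : AvoidsIntegers xK
  x-avoids n = nonvanishing-by-coeff (num (proj₁ (nK n -K xK))) 1 (ℤ.- + 1) refl (P∤1 ∘ Div.∣m⇒∣-m)
  t-avoids : AvoidsIntegers tK
  t-avoids n = nonvanishing-by-coeff (num (proj₁ (nK n -K tK))) 1 (ℤ.- + 1) refl (P∤1 ∘ Div.∣m⇒∣-m)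
  w-avoids : AvoidsIntegers wK
  w-avoids n = nonvanishing-by-coeff (num (proj₁ (nK n -K wK))) 1 (ℤ.- + 2) refl (P∤2 ∘ Div.∣m⇒∣-m)
  2t-avoids : AvoidsIntegers 2tK
  2t-avoids n = nonvanishing-by-coeff (num (proj₁ (nK n -K 2tK))) 1 (ℤ.- + 2) refl (P∤2 ∘ Div.∣m⇒∣-m)

  G-val S-val G-prev S-prev : ℕ → ℕ → K
  G-val a b = (tK *K tK) *K (inv (tK *K tK) *K msum p 0 (args 2tK tK a b))
  S-val a b = (xK *K xK) *K (inv (xK *K xK) *K msum p 0 (args wK xK a b))
  G-prev zero b = (tK *K tK) *K (inv (2tK *K tK) *K msum p 0 (replicate b tK))
  G-prev (suc a) b = G-val a b
  S-prev a zero = (xK *K xK) *K (inv (xK *K wK) *K msum p 0 (replicate a xK))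
  S-prev a (suc b) = S-val a b

  G-val-underlying : ∀ a b → Gc p (suc a) (suc b) (X -R natR 1) ≡ proj₁ (G-val a b)
  G-val-underlying a b = tilde-underlying tK 2tK tK (suc a) (suc b) tK tK (args 2tK tK a b)
    (cong (tK ∷_) (args-snoc 2tK tK a b)) (nonzero-* tK tK t≢0 t≢0) (all-args a b 2t-avoids t-avoids)

  S-val-underlying : ∀ a b → Sc p (suc a) (suc b) X ≡ proj₁ (S-val a b)
  S-val-underlying a b = tilde-underlying xK wK xK (suc a) (suc b) xK xK (args wK xK a b)
    (cong (xK ∷_) (args-snoc wK xK a b)) (nonzero-* xK xK x≢0 x≢0) (all-args a b w-avoids x-avoids)

  G-prev-underlying : ∀ a b → Gc p a (suc b) (X -R natR 1) ≡ proj₁ (G-prev a b)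
  G-prev-underlying zero b = tilde-underlying tK 2tK tK 0 (suc b) 2tK tK (replicate b tK)
    (cong (2tK ∷_) (replicate-snoc b tK)) (nonzero-* 2tK tK 2t≢0 t≢0) (AllP.replicate⁺ b t-avoids)
  G-prev-underlying (suc a) b = G-val-underlying a b

  S-prev-underlying : ∀ a b → Sc p (suc a) b X ≡ proj₁ (S-prev a b)
  S-prev-underlying a zero = tilde-underlying xK wK xK (suc a) 0 xK wK (replicate a xK)
    refl (nonzero-* xK wK x≢0 w≢0) (AllP.replicate⁺ a x-avoids)
  S-prev-underlying a (suc b) = S-val-underlying a b

  G-args-shift : ∀ a b → msum p 0 (args 2tK tK a b) ≈K msum (suc p) 1 (args wK xK a b)
  G-args-shift a b = K-trans {msum p 0 (args 2tK tK a b)} {msum p 0 (map (_-K 1K) (args wK xK a b))}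
    (msum-cong p 0 shifted) (msum-shift p 0 (args wK xK a b))
    where
      2t≈w-1 : 2tK ≈K (wK -K 1K)
      2t≈w-1 = solve 1 (λ x → con (+ 2) :* (x :- con (+ 1)) := (con (+ 2) :* x :- con (+ 1)) :- con (+ 1)) K-refl xK
      shifted : Pw.Pointwise _≈K_ (args 2tK tK a b) (map (_-K 1K) (args wK xK a b))
      shifted = subst (Pw.Pointwise _≈K_ (args 2tK tK a b)) (sym (map-args (_-K 1K) wK xK a b))
        (Pw.++⁺ (Pw.refl K-refl) (2t≈w-1 Pw.∷ Pw.refl K-refl))

  replicate-shift : ∀ b → msum p 0 (replicate b tK) ≈K msum (suc p) 1 (replicate b xK)
  replicate-shift b = K-trans {msum p 0 (replicate b tK)} {msum p 0 (map (_-K 1K) (replicate b xK))}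
    (≡⇒≈K (cong (msum p 0) (sym (LP.map-replicate (_-K 1K) b xK)))) (msum-shift p 0 (replicate b xK))

  outer : ℕ → K
  outer zero = wK
  outer (suc _) = xK

  dropFirst dropLast : ℕ → ℕ → List K
  dropFirst zero b = replicate b xK
  dropFirst (suc a) b = args wK xK a b
  dropLast a zero = replicate a xK
  dropLast a (suc b) = args wK xK a b

  args-first : ∀ a b → args wK xK a b ≡ outer a ∷ dropFirst a b
  args-first zero b = refl
  args-first (suc a) b = refl

  args-last : ∀ a b → args wK xK a b ≡ dropLast a b ++ outer b ∷ []
  args-last a zero = refl
  args-last a (suc b) = args-snoc wK xK a b

  G-prev-boundary : ∀ a b → (inv tK *K G-prev a b) ≈K (-K (inv (nK 1 -K outer a) *K msum (suc p) 1 (dropFirst a b)))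
  G-prev-boundary zero b = begin
      inv tK *K G-prev zero b
    ≈⟨ cancel-square-inv tK 2tK (msum p 0 (replicate b tK)) t≢0 2t≢0 ⟩
      inv 2tK *K msum p 0 (replicate b tK)
    ≈⟨ *K-cong {inv 2tK} K-refl (replicate-shift b) ⟩
      inv 2tK *K msum (suc p) 1 (replicate b xK)
    ≈⟨ negate-factor (inv (nK 1 -K wK)) (inv 2tK) (msum (suc p) 1 (replicate b xK)) (inv-of-negative (nK 1 -K wK) 2tK 2t≢0
         (solve 1 (λ x → con (+ 1) :- (con (+ 2) :* x :- con (+ 1)) := :- (con (+ 2) :* (x :- con (+ 1)))) K-refl xK)) ⟩
      -K (inv (nK 1 -K wK) *K msum (suc p) 1 (replicate b xK))
    ∎ where open ≈K-Reasoning
  G-prev-boundary (suc a) b = begin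
      inv tK *K G-val a b
    ≈⟨ *K-cong {inv tK} K-refl (cancel-square tK (msum p 0 (args 2tK tK a b)) t≢0) ⟩
      inv tK *K msum p 0 (args 2tK tK a b)
    ≈⟨ *K-cong {inv tK} K-refl (G-args-shift a b) ⟩
      inv tK *K msum (suc p) 1 (args wK xK a b)
    ≈⟨ negate-factor (inv (nK 1 -K xK)) (inv tK) (msum (suc p) 1 (args wK xK a b)) (inv-of-negative (nK 1 -K xK) tK t≢0
         (solve 1 (λ x → con (+ 1) :- x := :- (x :- con (+ 1))) K-refl xK)) ⟩
      -K (inv (nK 1 -K xK) *K msum (suc p) 1 (args wK xK a b))
    ∎ where open ≈K-Reasoning

  inv-p-minus : ∀ z → Nonzero z → inv (nK p -K z) ≈K (-K inv z)
  inv-p-minus z nz = inv-of-negative (nK p -K z) z nz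
    (K-trans {nK p -K z} {0K -K z} (+K-cong {nK p} {0K} { -K z} { -K z} p≈0 K-refl) (+K-identityˡ (-K z)))

  S-prev-boundary : ∀ a b → (inv xK *K S-prev a b) ≈K (-K (inv (nK p -K outer b) *K msum p 0 (dropLast a b)))
  S-prev-boundary a zero = begin
      inv xK *K ((xK *K xK) *K (inv (xK *K wK) *K F))
    ≈⟨ *K-cong {inv xK} K-refl (*K-cong {xK *K xK} K-refl
         (*K-cong {inv (xK *K wK)} {inv (wK *K xK)} {F} (inv-cong {xK *K wK} {wK *K xK} (*K-comm xK wK)) K-refl)) ⟩
      inv xK *K ((xK *K xK) *K (inv (wK *K xK) *K F))
    ≈⟨ cancel-square-inv xK wK F x≢0 w≢0 ⟩
      inv wK *K F
    ≈⟨ negate-factor (inv (nK p -K wK)) (inv wK) F (inv-p-minus wK w≢0) ⟩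
      -K (inv (nK p -K wK) *K F)
    ∎ where
      open ≈K-Reasoning
      F = msum p 0 (replicate a xK)
  S-prev-boundary a (suc b) = begin
      inv xK *K S-val a b
    ≈⟨ *K-cong {inv xK} K-refl (cancel-square xK F x≢0) ⟩
      inv xK *K F
    ≈⟨ negate-factor (inv (nK p -K xK)) (inv xK) F (inv-p-minus xK x≢0) ⟩
      -K (inv (nK p -K xK) *K F)
    ∎ where
      open ≈K-Reasoning
      F = msum p 0 (args wK xK a b)

  shift-identity : ∀ a b → (G-val a b -K S-val a b) ≈K ((inv tK *K G-prev a b) -K (inv xK *K S-prev a b))
  shift-identity a b = begin
      G-val a b -K S-val a b
    ≈⟨ +K-cong {G-val a b} {msum (suc p) 1 z} { -K S-val a b} { -K msum p 0 z}
         (K-trans {G-val a b} {msum p 0 (args 2tK tK a b)} (cancel-square tK _ t≢0) (G-args-shift a b))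
         (-K-cong {S-val a b} {msum p 0 z} (cancel-square xK _ x≢0)) ⟩
      msum (suc p) 1 z -K msum p 0 z
    ≡⟨ cong (λ l → msum (suc p) 1 l -K msum p 0 l) (args-first a b) ⟩
      msum (suc p) 1 (outer a ∷ dropFirst a b) -K msum p 0 (outer a ∷ dropFirst a b)
    ≈⟨ boundary p 1<p (outer a) (dropFirst a b) (dropLast a b) (outer b) (trans (sym (args-first a b)) (args-last a b)) ⟩
      V -K U
    ≈⟨ solve 2 (λ U V → V :- U := (:- U) :- (:- V)) K-refl U V ⟩
      (-K U) -K (-K V)
    ≈⟨ +K-cong { -K U} {inv tK *K G-prev a b} { -K (-K V)} { -K (inv xK *K S-prev a b)}
         (K-sym (G-prev-boundary a b)) (-K-cong { -K V} {inv xK *K S-prev a b} (K-sym (S-prev-boundary a b))) ⟩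
      (inv tK *K G-prev a b) -K (inv xK *K S-prev a b)
    ∎ where
      open ≈K-Reasoning
      z = args wK xK a b
      U V : K
      U = inv (nK 1 -K outer a) *K msum (suc p) 1 (dropFirst a b)
      V = inv (nK p -K outer b) *K msum p 0 (dropLast a b)

lemma2p3 : (p : ℕ) → Prime p → p ≢ 2 → (a b : ℕ) →
    WellDefined p ((Gc p (suc a) (suc b) (X -R natR 1)) -R (Sc p (suc a) (suc b) X))
    × WellDefined p ((invR (X -R natR 1) *R Gc p a (suc b) (X -R natR 1)) -R (invR X *R Sc p (suc a) b X))
    × (((Gc p (suc a) (suc b) (X -R natR 1)) -R (Sc p (suc a) (suc b) X))
    ≈[ p ] ((invR (X -R natR 1) *R Gc p a (suc b) (X -R natR 1)) -R (invR X *R Sc p (suc a) b X)))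
lemma2p3 p isPrime p≢2 a b =
  transfer (G-val a b -K S-val a b) ((inv tK *K G-prev a b) -K (inv xK *K S-prev a b))
    (cong₂ _-R_ (G-val-underlying a b) (S-val-underlying a b))
    (cong₂ _-R_ (cong₂ _*R_ (sym (inv-underlying tK t≢0)) (G-prev-underlying a b))
                (cong₂ _*R_ (sym (inv-underlying xK x≢0)) (S-prev-underlying a b)))
    (shift-identity a b)
  where
    open FractionField p isPrime
    open Specialisation p isPrime p≢2
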